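{- Let $G$ and $H$ be regular graphs which are both Ricci-flat. Then the Cartesian product $G\square H$ is Ricci-flat.
   Context: Graphs are simple with countably many vertices, each of finite degree. The Cartesian product $G\square H$ has vertex set $V(G)\times V(H)$, with $(u_1,v_1)\sim(u_2,v_2)$ iff ($u_1=u_2$ and $v_1v_2\in E(H)$) or ($u_1u_2\in E(G)$ and $v_1=v_2$). For a vertex $x$ let $\Gamma(x)$ be its neighbors, $d_x=|\Gamma(x)|$, and $d$ the graph distance. For $\alpha\in[0,1]$ let $m_x^\alpha(x)=\alpha$, $m_x^\alpha(v)=\frac{1-\alpha}{d_x}$ for $v\in\Gamma(x)$, $0$ otherwise. $W(m_1,m_2)=\inf_A\sum A(x,y)d(x,y)$ over couplings $A$ of $m_1,m_2$. $\kappa_\alpha(x,y)=1-\frac{W(m_x^\alpha,m_y^\alpha)}{d(x,y)}$, $\kappa(x,y)=\lim_{\alpha\to1}\frac{\kappa_\alpha(x,y)}{1-\alpha}$. A graph is Ricci-flat if $\kappa(x,y)=0$ for every edge $xy$.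
   Formalization: The parameter α ranges over the rationals in [0,1] and the couplings have rational entries, with the limit defining κ taken along rational α with rational tolerances. -}

module Defs where

open import Data.Nat as ℕ using (ℕ; zero; suc)
open import Data.Integer using (+_)
open import Data.Fin using (Fin; zero; suc)
open import Data.List using (List; _∷_; []; length; map; _++_; lookup)
open import Data.List.Membership.Propositional using (_∈_; _∉_)
open import Data.List.Relation.Unary.Unique.Propositional using (Unique)
open import Data.Rational using (ℚ; 0ℚ; 1ℚ; _+_; _*_; _-_; _≤_; _<_; ∣_∣; _/_; Positive)
open import Data.Product using (Σ; _×_; _,_)
open import Relation.Binary.PropositionalEquality using (_≡_)
open import Relation.Binary.Definitions using (DecidableEquality)
open import Function.Definitions using (Injective)

record PreGraph : Set₁ where
  field
    V    : Set
    nbrs : V → List V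

sumFin : (n : ℕ) → (Fin n → ℚ) → ℚ
sumFin zero    f = 0ℚ
sumFin (suc n) f = f zero + sumFin n (λ i → f (suc i))

ℕ→ℚ : ℕ → ℚ
ℕ→ℚ n = + n / 1

-- m_x^α on the support list  x ∷ Γ(x)  of length 1 + d_x :
-- index 0 is x (mass α), the other d_x indices are the neighbours (mass (1-α)/d_x).
mass : ℚ → (d : ℕ) → Fin (suc d) → ℚ
mass α d       zero    = α
mass α (suc k) (suc i) = (1ℚ - α) * (+ 1 / suc k)

_□_ : PreGraph → PreGraph → PreGraph
G □ H = record
  { V    = G.V × H.V
  ; nbrs = λ { (u , v) → map (λ v′ → (u , v′)) (H.nbrs v) ++ map (λ u′ → (u′ , v)) (G.nbrs u) }
  }
  where
    module G = PreGraph G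
    module H = PreGraph H

module _ (G : PreGraph) where
  open PreGraph G

  Adj : V → V → Set
  Adj x y = y ∈ nbrs x

  -- simple graph, countably many vertices, each of finite degree (neighbour lists are finite)
  record IsGraph : Set where
    field
      _≟_       : DecidableEquality V
      countable : Σ (V → ℕ) (λ f → Injective _≡_ _≡_ f)
      irrefl    : ∀ x → x ∉ nbrs x
      symm      : ∀ {x y} → Adj x y → Adj y x
      unique    : ∀ x → Unique (nbrs x)

  Regular : Set
  Regular = Σ ℕ (λ k → ∀ x → length (nbrs x) ≡ k)

  deg : V → ℕ
  deg x = length (nbrs x)

  data Walk : V → V → ℕ → Set where
    here : ∀ {x} → Walk x x 0
    step : ∀ {x y z n} → Adj x y → Walk y z n → Walk x z (suc n)

  Dist : V → V → ℕ → Set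
  Dist x y k = Walk x y k × (∀ m → Walk x y m → k ℕ.≤ m)

  supp : V → List V
  supp x = x ∷ nbrs x

  IsDistFn : (x y : V) → (Fin (suc (deg x)) → Fin (suc (deg y)) → ℕ) → Set
  IsDistFn x y D = ∀ i j → Dist (lookup (supp x) i) (lookup (supp y) j) (D i j)

  -- couplings of m_x^α and m_y^α (they vanish outside supp x × supp y)
  Coupling : (x y : V) → ℚ → (Fin (suc (deg x)) → Fin (suc (deg y)) → ℚ) → Set
  Coupling x y α A =
    (∀ i j → 0ℚ ≤ A i j) ×
    (∀ i → sumFin (suc (deg y)) (λ j → A i j) ≡ mass α (deg x) i) ×
    (∀ j → sumFin (suc (deg x)) (λ i → A i j) ≡ mass α (deg y) j)

  Cost : (x y : V) → (Fin (suc (deg x)) → Fin (suc (deg y)) → ℕ)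
       → (Fin (suc (deg x)) → Fin (suc (deg y)) → ℚ) → ℚ
  Cost x y D A = sumFin (suc (deg x)) (λ i → sumFin (suc (deg y)) (λ j → A i j * ℕ→ℚ (D i j)))

  IsW : (x y : V) → (Fin (suc (deg x)) → Fin (suc (deg y)) → ℕ) → ℚ → ℚ → Set
  IsW x y D α w =
    (∀ A → Coupling x y α A → w ≤ Cost x y D A) ×
    (∀ ε → Positive ε → Σ _ (λ A → Coupling x y α A × Cost x y D A < w + ε))

  -- κ(x,y) = lim_{α→1} κ_α(x,y)/(1-α) = 0, where κ_α = 1 - W/d, d = d(x,y) = D 0 0.
  -- |κ_α/(1-α)| < ε  ⇔  |d - W| < ε (1-α) d   (d > 0).
  CurvatureZero : V → V → Set
  CurvatureZero x y =
    ∀ D → IsDistFn x y D →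
    ∀ ε → Positive ε →
    Σ ℚ (λ δ → Positive δ ×
      (∀ α → 0ℚ ≤ α → 1ℚ - δ < α → α < 1ℚ →
       ∀ w → IsW x y D α w →
       ∣ ℕ→ℚ (D zero zero) - w ∣ < ε * (1ℚ - α) * ℕ→ℚ (D zero zero)))

  RicciFlat : Set
  RicciFlat = ∀ x y → Adj x y → CurvatureZero x y

-- Take an edge (x,v) ~ (y,v) of G □ H along G (edges along H are symmetric), with G k-regular and
-- H l-regular, so that m_β of a product vertex puts β on it and u = (1 - β)/(k + l) on each neighbour.
-- The projection onto G is 1-Lipschitz and pushes m_β forward to the lazy measure with laziness αᵖ,
-- 1 - αᵖ = k u, so W ≥ W_G(αᵖ) > 1 - ε(1 - αᵖ) ≥ 1 - ε(1 - β). Conversely, the part of m_β on the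
-- G-fibre is c times the lazy measure with laziness αˢ; coupling it by an almost optimal G-coupling and
-- each neighbour (x,v′) with (y,v′) at distance 1 gives W < c (1 + ε(1 - αˢ)) + l u = 1 + ε k u.
-- Flatness of G only speaks about values that are Wasserstein distances, so W_G(α) must exist: a
-- transport problem whose marginals lie on a grid (1/N)ℤ has an optimal coupling on that grid, obtained
-- by cancelling cycles of off-grid entries and minimising over the finitely many grid couplings.

module Submission where

open import Data.Nat as ℕ using (ℕ; zero; suc)
import Data.Nat.Properties as ℕP
open import Data.Nat.Coprimality using (Coprime; 1-coprimeTo)
import Data.Nat.Coprimality as Coprimality
open import Data.Integer as ℤ using (ℤ; +_; -[1+_])
import Data.Integer.Properties as ℤP
open import Data.Fin as Fin using (Fin; zero; suc; toℕ; _↑ˡ_; _↑ʳ_; splitAt; join)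
import Data.Fin.Properties as FinP
open import Data.Fin.Permutation using (Permutation; permutation)
open import Data.Rational
open import Data.Rational.Properties
import Data.Rational.Unnormalised as ℚᵘ
import Data.Rational.Unnormalised.Properties as ℚᵘP
open import Data.Rational.Solver using (module +-*-Solver)
open import Data.Product using (Σ; _×_; _,_; proj₁; proj₂)
open import Data.Sum as Sum using (_⊎_; inj₁; inj₂)
open import Data.Sum.Properties using (swap-involutive)
open import Data.List using (List; []; _∷_; _++_; map; length; lookup; allFin; cartesianProduct)
import Data.List.Properties as ListP
open import Data.List.Membership.Propositional using (_∈_; lose)
open import Data.List.Membership.Propositional.Properties
  using (∈-allFin; ∈-cartesianProduct⁺; ∈-map⁺; ∈-map⁻; ∈-++⁺ˡ; ∈-++⁺ʳ; ∈-++⁻)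
open import Data.List.Relation.Unary.Any as Any using (Any; here; there)
open import Data.Vec as Vec using (Vec)
import Data.Vec.Properties as VecP
open import Data.Empty using (⊥; ⊥-elim)
open import Relation.Nullary using (Dec; yes; no; ¬_; ¬?)
open import Relation.Nullary.Decidable using (_×-dec_)
open import Relation.Binary.Definitions using (Tri; tri<; tri≈; tri>)
open import Relation.Binary.PropositionalEquality
open import Algebra.Bundles using (CommutativeRing)
import Algebra.Properties.CommutativeMonoid.Sum as MonoidSum

open import Defs

open +-*-Solver

module RationalArith where

  ℤ→ℚ : ℤ → ℚ
  ℤ→ℚ z = z / 1

  coprimeTo-1 : ∀ n → Coprime n 1
  coprimeTo-1 n = Coprimality.sym (1-coprimeTo n)

  ℤ→ℚ≡mkℚ : ∀ z → ℤ→ℚ z ≡ mkℚ z 0 (coprimeTo-1 ℤ.∣ z ∣)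
  ℤ→ℚ≡mkℚ (+ n)    = normalize-coprime (coprimeTo-1 n)
  ℤ→ℚ≡mkℚ -[1+ n ] = cong -_ (normalize-coprime (coprimeTo-1 (suc n)))

  toℚᵘ-ℤ→ℚ : ∀ z → toℚᵘ (ℤ→ℚ z) ℚᵘ.≃ ℚᵘ.mkℚᵘ z 0
  toℚᵘ-ℤ→ℚ z rewrite ℤ→ℚ≡mkℚ z = ℚᵘ.*≡* refl

  ℤ→ℚ-homo-+ : ∀ a b → ℤ→ℚ (a ℤ.+ b) ≡ ℤ→ℚ a + ℤ→ℚ b
  ℤ→ℚ-homo-+ a b = toℚᵘ-injective (ℚᵘP.≃-trans (toℚᵘ-ℤ→ℚ (a ℤ.+ b)) (ℚᵘP.≃-sym (ℚᵘP.≃-trans (toℚᵘ-homo-+ (ℤ→ℚ a) (ℤ→ℚ b))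
    (ℚᵘP.≃-trans (ℚᵘP.+-cong (toℚᵘ-ℤ→ℚ a) (toℚᵘ-ℤ→ℚ b)) (ℚᵘ.*≡* cross)))))
    where
    cross : (a ℤ.* + 1 ℤ.+ b ℤ.* + 1) ℤ.* + 1 ≡ (a ℤ.+ b) ℤ.* + 1
    cross rewrite ℤP.*-identityʳ a | ℤP.*-identityʳ b = refl

  ℤ→ℚ-homo-* : ∀ a b → ℤ→ℚ (a ℤ.* b) ≡ ℤ→ℚ a * ℤ→ℚ b
  ℤ→ℚ-homo-* a b = toℚᵘ-injective (ℚᵘP.≃-trans (toℚᵘ-ℤ→ℚ (a ℤ.* b)) (ℚᵘP.≃-sym (ℚᵘP.≃-trans (toℚᵘ-homo-* (ℤ→ℚ a) (ℤ→ℚ b))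
    (ℚᵘP.≃-trans (ℚᵘP.*-cong (toℚᵘ-ℤ→ℚ a) (toℚᵘ-ℤ→ℚ b)) (ℚᵘ.*≡* refl)))))

  ℤ→ℚ-homo‿- : ∀ a → ℤ→ℚ (ℤ.- a) ≡ - ℤ→ℚ a
  ℤ→ℚ-homo‿- a = toℚᵘ-injective (ℚᵘP.≃-trans (toℚᵘ-ℤ→ℚ (ℤ.- a)) (ℚᵘP.≃-sym (ℚᵘP.≃-trans (toℚᵘ-homo‿- (ℤ→ℚ a))
    (ℚᵘP.≃-trans (ℚᵘP.-‿cong (toℚᵘ-ℤ→ℚ a)) (ℚᵘ.*≡* refl)))))

  ℤ→ℚ-mono-≤ : ∀ {a b} → a ℤ.≤ b → ℤ→ℚ a ≤ ℤ→ℚ b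
  ℤ→ℚ-mono-≤ {a} {b} le rewrite ℤ→ℚ≡mkℚ a | ℤ→ℚ≡mkℚ b =
    *≤* (subst₂ ℤ._≤_ (sym (ℤP.*-identityʳ a)) (sym (ℤP.*-identityʳ b)) le)

  ℤ→ℚ-cancel-≤ : ∀ {a b} → ℤ→ℚ a ≤ ℤ→ℚ b → a ℤ.≤ b
  ℤ→ℚ-cancel-≤ {a} {b} le rewrite ℤ→ℚ≡mkℚ a | ℤ→ℚ≡mkℚ b with le
  ... | *≤* p = subst₂ ℤ._≤_ (ℤP.*-identityʳ a) (ℤP.*-identityʳ b) p

  ↥-ℤ→ℚ : ∀ z → ↥ (ℤ→ℚ z) ≡ z
  ↥-ℤ→ℚ z rewrite ℤ→ℚ≡mkℚ z = refl

  ℕ→ℚ-homo-+ : ∀ a b → ℕ→ℚ (a ℕ.+ b) ≡ ℕ→ℚ a + ℕ→ℚ b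
  ℕ→ℚ-homo-+ a b = trans (cong ℤ→ℚ (ℤP.pos-+ a b)) (ℤ→ℚ-homo-+ (+ a) (+ b))

  ℕ→ℚ-homo-* : ∀ a b → ℕ→ℚ (a ℕ.* b) ≡ ℕ→ℚ a * ℕ→ℚ b
  ℕ→ℚ-homo-* a b = trans (cong ℤ→ℚ (ℤP.pos-* a b)) (ℤ→ℚ-homo-* (+ a) (+ b))

  ℕ→ℚ-suc : ∀ a → ℕ→ℚ (suc a) ≡ 1ℚ + ℕ→ℚ a
  ℕ→ℚ-suc a = ℕ→ℚ-homo-+ 1 a

  ℕ→ℚ-mono-≤ : ∀ {a b} → a ℕ.≤ b → ℕ→ℚ a ≤ ℕ→ℚ b
  ℕ→ℚ-mono-≤ {a} {b} le = ℤ→ℚ-mono-≤ {+ a} {+ b} (ℤ.+≤+ le)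

  0≤ℕ→ℚ : ∀ a → 0ℚ ≤ ℕ→ℚ a
  0≤ℕ→ℚ a = ℕ→ℚ-mono-≤ {0} {a} ℕ.z≤n

  [z/1+k]*[1+k]≡z : ∀ z k → (z / suc k) * ℕ→ℚ (suc k) ≡ ℤ→ℚ z
  [z/1+k]*[1+k]≡z z k = toℚᵘ-injective (ℚᵘP.≃-trans (toℚᵘ-homo-* (z / suc k) (ℕ→ℚ (suc k)))
    (ℚᵘP.≃-trans (ℚᵘP.*-cong (toℚᵘ-fromℚᵘ (ℚᵘ.mkℚᵘ z k)) (toℚᵘ-ℤ→ℚ (+ suc k)))
    (ℚᵘP.≃-trans (ℚᵘ.*≡* cross) (ℚᵘP.≃-sym (toℚᵘ-ℤ→ℚ z)))))
    where
    cross : (z ℤ.* + suc k) ℤ.* + 1 ≡ z ℤ.* + (suc k ℕ.* 1)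
    cross rewrite ℤP.*-identityʳ (z ℤ.* + suc k) | ℕP.*-identityʳ k = refl

  [1/1+k]*[1+k]≡1 : ∀ k → (+ 1 / suc k) * ℕ→ℚ (suc k) ≡ 1ℚ
  [1/1+k]*[1+k]≡1 = [z/1+k]*[1+k]≡z (+ 1)

  p*↧p≡↥p : ∀ p → p * ℕ→ℚ (↧ₙ p) ≡ ℤ→ℚ (↥ p)
  p*↧p≡↥p p@(mkℚ n d _) = trans (cong (_* ℕ→ℚ (suc d)) (sym (↥p/↧p≡p p))) ([z/1+k]*[1+k]≡z n d)

  private variable p q r : ℚ

  p≤q⇒0≤q-p : p ≤ q → 0ℚ ≤ q - p
  p≤q⇒0≤q-p {p} {q} le = subst (_≤ q - p) (+-inverseʳ p) (+-monoˡ-≤ (- p) le)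

  0≤q-p⇒p≤q : 0ℚ ≤ q - p → p ≤ q
  0≤q-p⇒p≤q {q} {p} le = subst₂ _≤_ (+-identityˡ p) (solve 2 (λ p q → (q :- p) :+ p := q) refl p q) (+-monoˡ-≤ p le)

  p<q⇒0<q-p : p < q → 0ℚ < q - p
  p<q⇒0<q-p {p} {q} lt = subst (_< q - p) (+-inverseʳ p) (+-monoˡ-< (- p) lt)

  0<q-p⇒p<q : 0ℚ < q - p → p < q
  0<q-p⇒p<q {q} {p} lt = subst₂ _<_ (+-identityˡ p) (solve 2 (λ p q → (q :- p) :+ p := q) refl p q) (+-monoˡ-< p lt)

  *-nonNeg : 0ℚ ≤ p → 0ℚ ≤ q → 0ℚ ≤ p * q
  *-nonNeg {p} {q} hp hq = nonNegative⁻¹ (p * q) {{nonNeg*nonNeg⇒nonNeg p {{nonNegative hp}} q {{nonNegative hq}}}}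

  *-pos : 0ℚ < p → 0ℚ < q → 0ℚ < p * q
  *-pos {p} {q} hp hq = positive⁻¹ (p * q) {{pos*pos⇒pos p {{positive hp}} q {{positive hq}}}}

  +-nonNeg : 0ℚ ≤ p → 0ℚ ≤ q → 0ℚ ≤ p + q
  +-nonNeg {p} {q} hp hq = subst (_≤ p + q) (+-identityˡ 0ℚ) (+-mono-≤ hp hq)

  +-pos : 0ℚ < p → 0ℚ ≤ q → 0ℚ < p + q
  +-pos {p} {q} hp hq = subst (_< p + q) (+-identityˡ 0ℚ) (+-mono-<-≤ hp hq)

  *-monoˡ-≤-0≤ : 0ℚ ≤ r → p ≤ q → r * p ≤ r * q
  *-monoˡ-≤-0≤ {r} hr = *-monoˡ-≤-nonNeg r {{nonNegative hr}}

  *-monoʳ-<-0< : 0ℚ < r → p < q → r * p < r * q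
  *-monoʳ-<-0< {r} hr = *-monoʳ-<-pos r {{positive hr}}

  0<p⇒p≢0 : 0ℚ < p → ¬ p ≡ 0ℚ
  0<p⇒p≢0 h e = <⇒≢ h (sym e)

  0<1 : 0ℚ < 1ℚ
  0<1 = *<* (ℤ.+<+ (ℕ.s≤s ℕ.z≤n))

  0<ℕ→ℚ-suc : ∀ n → 0ℚ < ℕ→ℚ (suc n)
  0<ℕ→ℚ-suc n = subst (0ℚ <_) (sym (ℕ→ℚ-suc n)) (+-pos 0<1 (0≤ℕ→ℚ n))

  -- The reciprocal, extended by 0 at 0 so that it can be applied before positivity is known.
  recip : ℚ → ℚ
  recip p with p ≟ 0ℚ
  ... | yes _ = 0ℚ
  ... | no p≢0 = (1/ p) {{≢-nonZero p≢0}}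

  *-recipʳ : ∀ p → ¬ p ≡ 0ℚ → p * recip p ≡ 1ℚ
  *-recipʳ p p≢0 with p ≟ 0ℚ
  ... | yes p≡0 = ⊥-elim (p≢0 p≡0)
  ... | no p≢0′ = *-inverseʳ p {{≢-nonZero p≢0′}}

  *-recipˡ : ∀ p → ¬ p ≡ 0ℚ → recip p * p ≡ 1ℚ
  *-recipˡ p p≢0 = trans (*-comm (recip p) p) (*-recipʳ p p≢0)

  recip-pos : ∀ p → 0ℚ < p → 0ℚ < recip p
  recip-pos p hp with p ≟ 0ℚ
  ... | yes p≡0 = ⊥-elim (0<p⇒p≢0 hp p≡0)
  ... | no p≢0 = positive⁻¹ _ {{1/pos⇒pos p {{positive hp}}}}

  p≤∣p∣ : ∀ p → p ≤ ∣ p ∣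
  p≤∣p∣ p with ∣p∣≡p∨∣p∣≡-p p
  ... | inj₁ e = ≤-reflexive (sym e)
  ... | inj₂ e = ≤-trans (subst (_≤ 0ℚ) (solve 1 (λ p → :- (:- p) := p) refl p) (neg-antimono-≤ (subst (0ℚ ≤_) e (0≤∣p∣ p))))
                         (0≤∣p∣ p)

  -p≤∣p∣ : ∀ p → - p ≤ ∣ p ∣
  -p≤∣p∣ p = subst (- p ≤_) (∣-p∣≡∣p∣ p) (p≤∣p∣ (- p))

  p<q∧-p<q⇒∣p∣<q : p < q → - p < q → ∣ p ∣ < q
  p<q∧-p<q⇒∣p∣<q {p} h₁ h₂ with ∣p∣≡p∨∣p∣≡-p p
  ... | inj₁ e = subst (_< _) (sym e) h₁
  ... | inj₂ e = subst (_< _) (sym e) h₂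

module FinSum where

  open RationalArith

  private
    module ∑ = MonoidSum (CommutativeRing.+-commutativeMonoid +-*-commutativeRing)

  sumFin≡∑ : ∀ n (f : Fin n → ℚ) → sumFin n f ≡ ∑.sum f
  sumFin≡∑ zero    f = refl
  sumFin≡∑ (suc n) f = cong (λ s → f zero + s) (sumFin≡∑ n (λ i → f (suc i)))

  sum-cong : ∀ n {f g : Fin n → ℚ} → (∀ i → f i ≡ g i) → sumFin n f ≡ sumFin n g
  sum-cong zero    e = refl
  sum-cong (suc n) e = cong₂ _+_ (e zero) (sum-cong n (λ i → e (suc i)))

  sum-distrib-+ : ∀ n (f g : Fin n → ℚ) → sumFin n (λ i → f i + g i) ≡ sumFin n f + sumFin n g
  sum-distrib-+ zero    f g = refl
  sum-distrib-+ (suc n) f g rewrite sum-distrib-+ n (λ i → f (suc i)) (λ i → g (suc i)) =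
    solve 4 (λ a b c d → (a :+ b) :+ (c :+ d) := (a :+ c) :+ (b :+ d)) refl
      (f zero) (g zero) (sumFin n (λ i → f (suc i))) (sumFin n (λ i → g (suc i)))

  sum-*ˡ : ∀ n c (f : Fin n → ℚ) → sumFin n (λ i → c * f i) ≡ c * sumFin n f
  sum-*ˡ zero    c f = sym (*-zeroʳ c)
  sum-*ˡ (suc n) c f rewrite sum-*ˡ n c (λ i → f (suc i)) = sym (*-distribˡ-+ c (f zero) _)

  sum-*ˡ-zero : ∀ n c {f : Fin n → ℚ} → sumFin n f ≡ 0ℚ → sumFin n (λ i → c * f i) ≡ 0ℚ
  sum-*ˡ-zero n c {f} sum≡0 = trans (sum-*ˡ n c f) (trans (cong (c *_) sum≡0) (*-zeroʳ c))

  sum-*ʳ : ∀ n c (f : Fin n → ℚ) → sumFin n (λ i → f i * c) ≡ sumFin n f * c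
  sum-*ʳ n c f = trans (sum-cong n (λ i → *-comm (f i) c)) (trans (sum-*ˡ n c f) (*-comm c _))

  sum-zero : ∀ n → sumFin n (λ _ → 0ℚ) ≡ 0ℚ
  sum-zero zero    = refl
  sum-zero (suc n) = trans (+-identityˡ _) (sum-zero n)

  sum-zeros : ∀ n (f : Fin n → ℚ) → (∀ i → f i ≡ 0ℚ) → sumFin n f ≡ 0ℚ
  sum-zeros n f e = trans (sum-cong n e) (sum-zero n)

  sum-comm : ∀ m n (f : Fin m → Fin n → ℚ) →
    sumFin m (λ i → sumFin n (λ j → f i j)) ≡ sumFin n (λ j → sumFin m (λ i → f i j))
  sum-comm zero    n f = sym (sum-zero n)
  sum-comm (suc m) n f = trans (cong (λ s → sumFin n (f zero) + s) (sum-comm m n (λ i → f (suc i))))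
    (sym (sum-distrib-+ n (f zero) (λ j → sumFin m (λ i → f (suc i) j))))

  sum-neg : ∀ n (f : Fin n → ℚ) → sumFin n (λ i → - f i) ≡ - sumFin n f
  sum-neg zero    f = refl
  sum-neg (suc n) f rewrite sum-neg n (λ i → f (suc i)) =
    solve 2 (λ x y → :- x :+ :- y := :- (x :+ y)) refl (f zero) (sumFin n (λ i → f (suc i)))

  sum-sub : ∀ n (f g : Fin n → ℚ) → sumFin n (λ i → f i - g i) ≡ sumFin n f - sumFin n g
  sum-sub n f g = trans (sum-distrib-+ n f (λ i → - g i)) (cong (λ s → sumFin n f + s) (sum-neg n g))

  sum-const : ∀ n c → sumFin n (λ _ → c) ≡ ℕ→ℚ n * c
  sum-const zero    c = sym (*-zeroˡ c)
  sum-const (suc n) c rewrite sum-const n c | ℕ→ℚ-suc n =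
    solve 2 (λ c x → c :+ x :* c := (con 1ℚ :+ x) :* c) refl c (ℕ→ℚ n)

  sum-telescope : ∀ n (h : ℕ → ℚ) → sumFin n (λ k → h (toℕ k) - h (suc (toℕ k))) ≡ h 0 - h n
  sum-telescope zero    h = sym (+-inverseʳ (h 0))
  sum-telescope (suc n) h rewrite sum-telescope n (λ t → h (suc t)) =
    solve 3 (λ x y z → (x :- y) :+ (y :- z) := x :- z) refl (h 0) (h 1) (h (suc n))

  sum-mono-≤ : ∀ n {f g : Fin n → ℚ} → (∀ i → f i ≤ g i) → sumFin n f ≤ sumFin n g
  sum-mono-≤ zero    e = ≤-refl
  sum-mono-≤ (suc n) e = +-mono-≤ (e zero) (sum-mono-≤ n (λ i → e (suc i)))

  0≤sum : ∀ n {f : Fin n → ℚ} → (∀ i → 0ℚ ≤ f i) → 0ℚ ≤ sumFin n f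
  0≤sum n {f} e = subst (_≤ sumFin n f) (sum-zero n) (sum-mono-≤ n e)

  term≤sum : ∀ n (f : Fin n → ℚ) → (∀ i → 0ℚ ≤ f i) → ∀ i → f i ≤ sumFin n f
  term≤sum (suc n) f nn zero = subst (_≤ sumFin (suc n) f) (+-identityʳ (f zero))
    (+-monoʳ-≤ (f zero) (0≤sum n (λ i → nn (suc i))))
  term≤sum (suc n) f nn (suc i) = subst (_≤ sumFin (suc n) f) (+-identityˡ (f (suc i)))
    (+-mono-≤ (nn zero) (term≤sum n (λ i → f (suc i)) (λ i → nn (suc i)) i))

  sum-splitAt : ∀ a b (f : Fin (a ℕ.+ b) → ℚ) →
    sumFin (a ℕ.+ b) f ≡ sumFin a (λ i → f (i ↑ˡ b)) + sumFin b (λ j → f (a ↑ʳ j))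
  sum-splitAt zero    b f = sym (+-identityˡ _)
  sum-splitAt (suc a) b f rewrite sum-splitAt a b (λ i → f (suc i)) = sym (+-assoc (f zero) _ _)

  sum-⊎ : ∀ N a b (to : Fin N → Fin a ⊎ Fin b) (from : Fin a ⊎ Fin b → Fin N) →
    (∀ x → from (to x) ≡ x) → (∀ y → to (from y) ≡ y) → (g : Fin N → ℚ) →
    sumFin N g ≡ sumFin a (λ i → g (from (inj₁ i))) + sumFin b (λ j → g (from (inj₂ j)))
  sum-⊎ N a b to from from-to to-from g = begin
    sumFin N g                                     ≡⟨ sumFin≡∑ N g ⟩
    ∑.sum g                                        ≡⟨ ∑.sum-permute g π ⟩
    ∑.sum (λ k → g (from (splitAt a k)))           ≡⟨ sym (sumFin≡∑ (a ℕ.+ b) _) ⟩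
    sumFin (a ℕ.+ b) (λ k → g (from (splitAt a k))) ≡⟨ sum-splitAt a b _ ⟩
    _                                              ≡⟨ cong₂ _+_
      (sum-cong a (λ i → cong (λ z → g (from z)) (FinP.splitAt-↑ˡ a i b)))
      (sum-cong b (λ j → cong (λ z → g (from z)) (FinP.splitAt-↑ʳ a b j))) ⟩
    _ ∎
    where
    open ≡-Reasoning
    π : Permutation (a ℕ.+ b) N
    π = permutation (λ k → from (splitAt a k)) (λ x → join a b (to x))
          (λ y → trans (cong from (FinP.splitAt-join a b (to y))) (from-to y))
          (λ x → trans (cong (join a b) (to-from (splitAt a x))) (FinP.join-splitAt a b x))

  abstract
    δ : ∀ {n} → Fin n → Fin n → ℚ
    δ i j with i FinP.≟ j
    ... | yes _ = 1ℚ
    ... | no _ = 0ℚ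

    δ-refl : ∀ {n} (i : Fin n) → δ i i ≡ 1ℚ
    δ-refl i with i FinP.≟ i
    ... | yes _ = refl
    ... | no i≢i = ⊥-elim (i≢i refl)

    δ-≢ : ∀ {n} {i j : Fin n} → ¬ i ≡ j → δ i j ≡ 0ℚ
    δ-≢ {i = i} {j} i≢j with i FinP.≟ j
    ... | yes i≡j = ⊥-elim (i≢j i≡j)
    ... | no _ = refl

    δ-sym : ∀ {n} (i j : Fin n) → δ i j ≡ δ j i
    δ-sym i j = by-cases (i FinP.≟ j)
      where
      by-cases : Dec (i ≡ j) → δ i j ≡ δ j i
      by-cases (yes refl) = refl
      by-cases (no i≢j) = trans (δ-≢ i≢j) (sym (δ-≢ (λ e → i≢j (sym e))))

    δ-suc : ∀ {n} (i j : Fin n) → δ (suc i) (suc j) ≡ δ i j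
    δ-suc i j = by-cases (i FinP.≟ j)
      where
      by-cases : Dec (i ≡ j) → δ (suc i) (suc j) ≡ δ i j
      by-cases (yes refl) = trans (δ-refl (suc i)) (sym (δ-refl i))
      by-cases (no i≢j) = trans (δ-≢ (λ e → i≢j (FinP.suc-injective e))) (sym (δ-≢ i≢j))

    0≤δ : ∀ {n} (i j : Fin n) → 0ℚ ≤ δ i j
    0≤δ i j with i FinP.≟ j
    ... | yes _ = *≤* (ℤ.+≤+ ℕ.z≤n)
    ... | no _ = ≤-refl

  δ-0-suc : ∀ {n} (j : Fin n) → δ {suc n} zero (suc j) ≡ 0ℚ
  δ-0-suc j = δ-≢ (λ ())

  δ-suc-0 : ∀ {n} (i : Fin n) → δ {suc n} (suc i) zero ≡ 0ℚ
  δ-suc-0 i = δ-≢ (λ ())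

  sum-δˡ : ∀ n (i : Fin n) (f : Fin n → ℚ) → sumFin n (λ j → δ i j * f j) ≡ f i
  sum-δˡ (suc n) zero f = begin
    δ zero zero * f zero + sumFin n (λ j → δ zero (suc j) * f (suc j))
      ≡⟨ cong₂ _+_ (cong (_* f zero) (δ-refl zero))
                   (sum-zeros n _ (λ j → trans (cong (_* f (suc j)) (δ-0-suc j)) (*-zeroˡ (f (suc j))))) ⟩
    1ℚ * f zero + 0ℚ ≡⟨ trans (+-identityʳ _) (*-identityˡ (f zero)) ⟩
    f zero ∎
    where open ≡-Reasoning
  sum-δˡ (suc n) (suc i) f = begin
    δ (suc i) zero * f zero + sumFin n (λ j → δ (suc i) (suc j) * f (suc j))
      ≡⟨ cong₂ _+_ (trans (cong (_* f zero) (δ-suc-0 i)) (*-zeroˡ (f zero)))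
                   (sum-cong n (λ j → cong (_* f (suc j)) (δ-suc i j))) ⟩
    0ℚ + sumFin n (λ j → δ i j * f (suc j)) ≡⟨ trans (+-identityˡ _) (sum-δˡ n i (λ j → f (suc j))) ⟩
    f (suc i) ∎
    where open ≡-Reasoning

  sum-δʳ : ∀ n (i : Fin n) (f : Fin n → ℚ) → sumFin n (λ j → δ j i * f j) ≡ f i
  sum-δʳ n i f = trans (sum-cong n (λ j → cong (_* f j) (δ-sym j i))) (sum-δˡ n i f)

  sum-δ≡1 : ∀ n (i : Fin n) → sumFin n (λ j → δ i j) ≡ 1ℚ
  sum-δ≡1 n i = trans (sum-cong n (λ j → sym (*-identityʳ (δ i j)))) (sum-δˡ n i (λ _ → 1ℚ))

  sum-single : ∀ n (f : Fin n → ℚ) (k : Fin n) → (∀ l → ¬ l ≡ k → f l ≡ 0ℚ) → sumFin n f ≡ f k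
  sum-single n f k others = trans (sum-cong n f≡δf) (sum-δˡ n k f)
    where
    f≡δf : ∀ l → f l ≡ δ k l * f l
    f≡δf l with l FinP.≟ k
    ... | yes refl = sym (trans (cong (_* f l) (δ-refl l)) (*-identityˡ (f l)))
    ... | no l≢k = trans (others l l≢k) (sym (trans (cong (_* f l) (δ-≢ (λ e → l≢k (sym e)))) (*-zeroˡ (f l))))

open RationalArith
open FinSum

module Transport where

  IsCoupling : (p q : ℕ) → (Fin p → ℚ) → (Fin q → ℚ) → (Fin p → Fin q → ℚ) → Set
  IsCoupling p q a b A =
    (∀ i j → 0ℚ ≤ A i j) ×
    (∀ i → sumFin q (λ j → A i j) ≡ a i) ×
    (∀ j → sumFin p (λ i → A i j) ≡ b j)

  cost : (p q : ℕ) → (Fin p → Fin q → ℕ) → (Fin p → Fin q → ℚ) → ℚ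
  cost p q D A = sumFin p (λ i → sumFin q (λ j → A i j * ℕ→ℚ (D i j)))

  IsInfCost : (p q : ℕ) → (Fin p → ℚ) → (Fin q → ℚ) → (Fin p → Fin q → ℕ) → ℚ → Set
  IsInfCost p q a b D w =
    (∀ A → IsCoupling p q a b A → w ≤ cost p q D A) ×
    (∀ ε → Positive ε → Σ _ (λ A → IsCoupling p q a b A × cost p q D A < w + ε))

  infCost-mono : ∀ {p q p′ q′} a b D a′ b′ D′ {w w′} →
    IsInfCost p′ q′ a′ b′ D′ w′ → IsInfCost p q a b D w →
    (∀ A → IsCoupling p q a b A → Σ _ (λ B → IsCoupling p′ q′ a′ b′ B × cost p′ q′ D′ B ≤ cost p q D A)) →
    w′ ≤ w
  infCost-mono {p} {q} a b D a′ b′ D′ {w} {w′} (w′≤ , _) (_ , approx) transfer = ≮⇒≥ w<w′-impossible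
    where
    w<w′-impossible : w < w′ → ⊥
    w<w′-impossible w<w′ with approx (w′ - w) (positive (p<q⇒0<q-p w<w′))
    ... | A , A-coupling , A<w+[w′-w] with transfer A A-coupling
    ...   | B , B-coupling , B≤A = <-irrefl refl (≤-<-trans (≤-trans (w′≤ B B-coupling) B≤A)
            (subst (cost p q D A <_) (solve 2 (λ x y → x :+ (y :- x) := y) refl w w′) A<w+[w′-w]))

  coupling-below : ∀ {p q} a b D {w r} → IsInfCost p q a b D w → w < r →
    Σ _ (λ A → IsCoupling p q a b A × cost p q D A < r)
  coupling-below a b D {w} {r} (_ , approx) w<r with approx (r - w) (positive (p<q⇒0<q-p w<r))
  ... | A , A-coupling , A<w+[r-w] = A , A-coupling ,
    subst (_ <_) (solve 2 (λ x y → x :+ (y :- x) := y) refl w r) A<w+[r-w]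

  IsCoupling-cong : ∀ {p q a b} {A B : Fin p → Fin q → ℚ} →
    (∀ i j → A i j ≡ B i j) → IsCoupling p q a b A → IsCoupling p q a b B
  IsCoupling-cong {p} {q} e (nonNeg , rows , cols) =
    (λ i j → subst (0ℚ ≤_) (e i j) (nonNeg i j)) ,
    (λ i → trans (sym (sum-cong q (e i))) (rows i)) ,
    (λ j → trans (sym (sum-cong p (λ i → e i j))) (cols j))

  isCoupling? : ∀ p q a b (A : Fin p → Fin q → ℚ) → Dec (IsCoupling p q a b A)
  isCoupling? p q a b A =
    FinP.all? (λ i → FinP.all? (λ j → 0ℚ ≤? A i j)) ×-dec
    (FinP.all? (λ i → sumFin q (λ j → A i j) ≟ a i) ×-dec
     FinP.all? (λ j → sumFin p (λ i → A i j) ≟ b j))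

  cost-cong : ∀ {p q D} {A B : Fin p → Fin q → ℚ} → (∀ i j → A i j ≡ B i j) → cost p q D A ≡ cost p q D B
  cost-cong {p} {q} {D} e = sum-cong p (λ i → sum-cong q (λ j → cong (_* ℕ→ℚ (D i j)) (e i j)))

  cost-*ˡ : ∀ p q D (E : Fin p → Fin q → ℚ) s → cost p q D (λ i j → s * E i j) ≡ s * cost p q D E
  cost-*ˡ p q D E s =
    trans (sum-cong p (λ i → trans (sum-cong q (λ j → *-assoc s (E i j) _)) (sum-*ˡ q s _))) (sum-*ˡ p s _)

  cost-+ : ∀ p q D (A E : Fin p → Fin q → ℚ) →
    cost p q D (λ i j → A i j + E i j) ≡ cost p q D A + cost p q D E
  cost-+ p q D A E = trans
    (sum-cong p (λ i → trans (sum-cong q (λ j → *-distribʳ-+ (ℕ→ℚ (D i j)) (A i j) (E i j))) (sum-distrib-+ q _ _)))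
    (sum-distrib-+ p _ _)

  IsCoupling-+ : ∀ {p q a b} (A E : Fin p → Fin q → ℚ) → IsCoupling p q a b A →
    (∀ i → sumFin q (E i) ≡ 0ℚ) → (∀ j → sumFin p (λ i → E i j) ≡ 0ℚ) →
    (∀ i j → 0ℚ ≤ A i j + E i j) → IsCoupling p q a b (λ i j → A i j + E i j)
  IsCoupling-+ {p} {q} {a} {b} A E (_ , rows , cols) E-rows E-cols nonNeg = nonNeg ,
    (λ i → trans (sum-distrib-+ q (A i) (E i)) (trans (cong₂ _+_ (rows i) (E-rows i)) (+-identityʳ (a i)))) ,
    (λ j → trans (sum-distrib-+ p (λ i → A i j) (λ i → E i j)) (trans (cong₂ _+_ (cols j) (E-cols j)) (+-identityʳ (b j))))

module ListMin where

  argmin : ∀ {X : Set} (P : X → Set) → (∀ x → Dec (P x)) → (f : X → ℚ) → (xs : List X) →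
    Any P xs → Σ X (λ y → P y × (∀ z → z ∈ xs → P z → f y ≤ f z))
  argmin P P? f (x ∷ xs) h with P? x | Any.any? P? xs
  ... | yes px | no ¬xs = x , px , λ { z (here refl) pz → ≤-refl ; z (there z∈) pz → ⊥-elim (¬xs (lose z∈ pz)) }
  ... | no ¬px | no ¬xs = ⊥-elim (none h)
    where
    none : Any P (x ∷ xs) → ⊥
    none (here px) = ¬px px
    none (there a) = ¬xs a
  ... | no ¬px | yes hxs with argmin P P? f xs hxs
  ...   | y , py , min = y , py , λ { z (here refl) pz → ⊥-elim (¬px pz) ; z (there z∈) pz → min z z∈ pz }
  argmin P P? f (x ∷ xs) h | yes px | yes hxs with argmin P P? f xs hxs
  ...   | y , py , min with f x ≤? f y
  ...     | yes fx≤fy = x , px , λ { z (here refl) pz → ≤-refl ; z (there z∈) pz → ≤-trans fx≤fy (min z z∈ pz) }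
  ...     | no fx≰fy = y , py , λ { z (here refl) pz → <⇒≤ (≰⇒> fx≰fy) ; z (there z∈) pz → min z z∈ pz }

module Grid (N : ℕ) where

  record OnGrid (x : ℚ) : Set where
    constructor _,_
    field
      scaled   : ℤ
      scaled≡ : x * ℕ→ℚ N ≡ ℤ→ℚ scaled

  OnGrid-0 : OnGrid 0ℚ
  OnGrid-0 = + 0 , *-zeroˡ (ℕ→ℚ N)

  OnGrid-+ : ∀ {x y} → OnGrid x → OnGrid y → OnGrid (x + y)
  OnGrid-+ {x} {y} (a , ea) (b , eb) = a ℤ.+ b ,
    trans (*-distribʳ-+ (ℕ→ℚ N) x y) (trans (cong₂ _+_ ea eb) (sym (ℤ→ℚ-homo-+ a b)))

  OnGrid-neg : ∀ {x} → OnGrid x → OnGrid (- x)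
  OnGrid-neg {x} (a , ea) = ℤ.- a ,
    trans (sym (neg-distribˡ-* x (ℕ→ℚ N))) (trans (cong -_ ea) (sym (ℤ→ℚ-homo‿- a)))

  OnGrid-sum : ∀ n (f : Fin n → ℚ) → (∀ i → OnGrid (f i)) → OnGrid (sumFin n f)
  OnGrid-sum zero    f h = OnGrid-0
  OnGrid-sum (suc n) f h = OnGrid-+ (h zero) (OnGrid-sum n (λ i → f (suc i)) (λ i → h (suc i)))

  OnGrid-cong : ∀ {x y} → x ≡ y → OnGrid x → OnGrid y
  OnGrid-cong refl g = g

  onGrid? : ∀ x → Dec (OnGrid x)
  onGrid? x with x * ℕ→ℚ N ≟ ℤ→ℚ (↥ (x * ℕ→ℚ N))
  ... | yes e = yes (↥ (x * ℕ→ℚ N) , e)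
  ... | no ¬e = no λ { (a , e) → ¬e (trans e (cong ℤ→ℚ (sym (trans (cong ↥_ e) (↥-ℤ→ℚ a))))) }

  OnGrid-lastTerm : ∀ n (f : Fin n → ℚ) (k : Fin n) → OnGrid (sumFin n f) →
    (∀ l → ¬ l ≡ k → OnGrid (f l)) → OnGrid (f k)
  OnGrid-lastTerm n f k onSum others =
    OnGrid-cong difference (OnGrid-+ onSum (OnGrid-neg (OnGrid-sum n g onGrid-g)))
    where
    g : Fin n → ℚ
    g l = (1ℚ - δ k l) * f l
    onGrid-g : ∀ l → OnGrid (g l)
    onGrid-g l with l FinP.≟ k
    ... | yes refl = OnGrid-cong (sym (trans (cong (λ d → (1ℚ - d) * f l) (δ-refl l))
                       (trans (cong (_* f l) (+-inverseʳ 1ℚ)) (*-zeroˡ (f l))))) OnGrid-0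
    ... | no l≢k = OnGrid-cong (sym (trans (cong (λ d → (1ℚ - d) * f l) (δ-≢ (λ e → l≢k (sym e))))
                     (*-identityˡ (f l)))) (others l l≢k)
    difference : sumFin n f - sumFin n g ≡ f k
    difference = begin
      sumFin n f - sumFin n g
        ≡⟨ cong (_- sumFin n g) (sum-cong n (λ l → solve 2 (λ d x → x := d :* x :+ (con 1ℚ :- d) :* x) refl (δ k l) (f l))) ⟩
      sumFin n (λ l → δ k l * f l + g l) - sumFin n g ≡⟨ cong (_- sumFin n g) (sum-distrib-+ n _ g) ⟩
      sumFin n (λ l → δ k l * f l) + sumFin n g - sumFin n g ≡⟨ solve 2 (λ a b → a :+ b :- b := a) refl _ (sumFin n g) ⟩
      sumFin n (λ l → δ k l * f l) ≡⟨ sum-δˡ n k f ⟩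
      f k ∎
      where open ≡-Reasoning

module FirstRepeat {p : ℕ} (f : ℕ → Fin p) where

  Distinct : ℕ → Set
  Distinct b = ∀ s t → s ℕ.< b → t ℕ.< b → f s ≡ f t → s ≡ t

  Repeat : Set
  Repeat = Σ ℕ (λ b → Σ ℕ (λ a → a ℕ.< b × f a ≡ f b × Distinct b))

  distinct⊎repeat : ∀ n → Distinct n ⊎ Repeat
  distinct⊎repeat zero = inj₁ (λ { s t () _ _ })
  distinct⊎repeat (suc n) with distinct⊎repeat n
  ... | inj₂ r = inj₂ r
  ... | inj₁ d with FinP.any? (λ (k : Fin n) → f (toℕ k) FinP.≟ f n)
  ...   | yes (k , e) = inj₂ (n , toℕ k , FinP.toℕ<n k , e , d)
  ...   | no ¬e = inj₁ d′
    where
    d′ : Distinct (suc n)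
    d′ s t s< t< e with ℕP.m<1+n⇒m<n∨m≡n s< | ℕP.m<1+n⇒m<n∨m≡n t<
    ... | inj₁ s<n  | inj₁ t<n  = d s t s<n t<n e
    ... | inj₂ refl | inj₂ refl = refl
    ... | inj₂ refl | inj₁ t<n  = ⊥-elim (¬e (Fin.fromℕ< t<n , trans (cong f (FinP.toℕ-fromℕ< t<n)) (sym e)))
    ... | inj₁ s<n  | inj₂ refl = ⊥-elim (¬e (Fin.fromℕ< s<n , trans (cong f (FinP.toℕ-fromℕ< s<n)) e))

  firstRepeat : Repeat
  firstRepeat with distinct⊎repeat (suc p)
  ... | inj₂ r = r
  ... | inj₁ d with FinP.pigeonhole (ℕP.n<1+n p) (λ k → f (toℕ k))
  ...   | i , j , i<j , e = ⊥-elim (ℕP.<⇒≢ i<j (d (toℕ i) (toℕ j) (FinP.toℕ<n i) (FinP.toℕ<n j) e))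

-- A coupling with an off-grid entry while all marginals are on the grid contains a cycle of off-grid
-- cells, alternating between column moves and row moves; E is the ±1 circulation around it.
module Cycle (N p q : ℕ) (a : Fin p → ℚ) (b : Fin q → ℚ)
  (a-onGrid : ∀ i → Grid.OnGrid N (a i)) (b-onGrid : ∀ j → Grid.OnGrid N (b j))
  (A : Fin p → Fin q → ℚ) (A-coupling : Transport.IsCoupling p q a b A)
  (i₀ : Fin p) (j₀ : Fin q) (offGrid₀ : ¬ Grid.OnGrid N (A i₀ j₀)) where

  open Grid N

  OffGrid : Fin p → Fin q → Set
  OffGrid i j = ¬ OnGrid (A i j)

  otherInColumn : ∀ i j → OffGrid i j → Σ (Fin p) (λ i′ → ¬ i′ ≡ i × OffGrid i′ j)
  otherInColumn i j off with FinP.any? (λ i′ → ¬? (i′ FinP.≟ i) ×-dec ¬? (onGrid? (A i′ j)))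
  ... | yes found = found
  ... | no none = ⊥-elim (off (OnGrid-lastTerm p (λ i′ → A i′ j) i
                    (OnGrid-cong (sym (proj₂ (proj₂ A-coupling) j)) (b-onGrid j)) rest))
    where
    rest : ∀ i′ → ¬ i′ ≡ i → OnGrid (A i′ j)
    rest i′ i′≢i with onGrid? (A i′ j)
    ... | yes on = on
    ... | no ¬on = ⊥-elim (none (i′ , i′≢i , ¬on))

  otherInRow : ∀ i j → OffGrid i j → Σ (Fin q) (λ j′ → ¬ j′ ≡ j × OffGrid i j′)
  otherInRow i j off with FinP.any? (λ j′ → ¬? (j′ FinP.≟ j) ×-dec ¬? (onGrid? (A i j′)))
  ... | yes found = found
  ... | no none = ⊥-elim (off (OnGrid-lastTerm q (A i) j
                    (OnGrid-cong (sym (proj₁ (proj₂ A-coupling) i)) (a-onGrid i)) rest))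
    where
    rest : ∀ j′ → ¬ j′ ≡ j → OnGrid (A i j′)
    rest j′ j′≢j with onGrid? (A i j′)
    ... | yes on = on
    ... | no ¬on = ⊥-elim (none (j′ , j′≢j , ¬on))

  record Cell : Set where
    constructor cell
    field
      row     : Fin p
      col     : Fin q
      offGrid : OffGrid row col

  next : Cell → Cell
  next (cell i j off) = cell (proj₁ C) (proj₁ R) (proj₂ (proj₂ R))
    where
    C = otherInColumn i j off
    R = otherInRow (proj₁ C) j (proj₂ (proj₂ C))

  abstract
    walk : ℕ → Cell
    walk zero    = cell i₀ j₀ offGrid₀
    walk (suc t) = next (walk t)

    r : ℕ → Fin p
    r t = Cell.row (walk t)

    c : ℕ → Fin q
    c t = Cell.col (walk t)

    offGrid-rc : ∀ t → OffGrid (r t) (c t)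
    offGrid-rc t = Cell.offGrid (walk t)

    offGrid-turn : ∀ t → OffGrid (r (suc t)) (c t)
    offGrid-turn t = proj₂ (proj₂ (otherInColumn (r t) (c t) (offGrid-rc t)))

    r-moves : ∀ t → ¬ r (suc t) ≡ r t
    r-moves t = proj₁ (proj₂ (otherInColumn (r t) (c t) (offGrid-rc t)))

    c-moves : ∀ t → ¬ c (suc t) ≡ c t
    c-moves t = proj₁ (proj₂ (otherInRow (r (suc t)) (c t) (offGrid-turn t)))

  open FirstRepeat r using (Repeat; firstRepeat; Distinct)

  abstract
    repeat : Repeat
    repeat = firstRepeat

    start end : ℕ
    end   = proj₁ repeat
    start = proj₁ (proj₂ repeat)

    start<end : start ℕ.< end
    start<end = proj₁ (proj₂ (proj₂ repeat))

    r-start≡r-end : r start ≡ r end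
    r-start≡r-end = proj₁ (proj₂ (proj₂ (proj₂ repeat)))

    r-distinct : Distinct end
    r-distinct = proj₂ (proj₂ (proj₂ (proj₂ repeat)))

  L : ℕ
  L = end ℕ.∸ start

  start+L≡end : start ℕ.+ L ≡ end
  start+L≡end = ℕP.m+[n∸m]≡n (ℕP.<⇒≤ start<end)

  start+k<end : ∀ (k : Fin L) → start ℕ.+ toℕ k ℕ.< end
  start+k<end k = subst (start ℕ.+ toℕ k ℕ.<_) start+L≡end (ℕP.+-monoʳ-< start (FinP.toℕ<n k))

  term : ℕ → Fin p → Fin q → ℚ
  term t i j = (δ (r t) i - δ (r (suc t)) i) * δ (c t) j

  E : Fin p → Fin q → ℚ
  E i j = sumFin L (λ k → (δ (r (start ℕ.+ toℕ k)) i - δ (r (start ℕ.+ suc (toℕ k))) i) * δ (c (start ℕ.+ toℕ k)) j)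

  E≡sum-term : ∀ i j → E i j ≡ sumFin L (λ k → term (start ℕ.+ toℕ k) i j)
  E≡sum-term i j = sum-cong L (λ k →
    cong (λ u → (δ (r (start ℕ.+ toℕ k)) i - δ (r u) i) * δ (c (start ℕ.+ toℕ k)) j) (ℕP.+-suc start (toℕ k)))

  E-row-sum : ∀ i → sumFin q (E i) ≡ 0ℚ
  E-row-sum i = begin
    sumFin q (E i)                                           ≡⟨ sum-comm q L _ ⟩
    sumFin L (λ k → sumFin q (λ j → Δ k * δ (c (start ℕ.+ toℕ k)) j)) ≡⟨ sum-cong L (λ k → sum-Δδ k) ⟩
    sumFin L Δ                                               ≡⟨ sum-telescope L h ⟩
    h 0 - h L                                                ≡⟨ cong₂ (λ u v → δ (r u) i - δ (r v) i) (ℕP.+-identityʳ start) start+L≡end ⟩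
    δ (r start) i - δ (r end) i                              ≡⟨ cong (λ u → δ u i - δ (r end) i) r-start≡r-end ⟩
    δ (r end) i - δ (r end) i                                ≡⟨ +-inverseʳ (δ (r end) i) ⟩
    0ℚ                                                       ∎
    where
    open ≡-Reasoning
    h : ℕ → ℚ
    h t = δ (r (start ℕ.+ t)) i
    Δ : Fin L → ℚ
    Δ k = h (toℕ k) - h (suc (toℕ k))
    sum-Δδ : ∀ k → sumFin q (λ j → Δ k * δ (c (start ℕ.+ toℕ k)) j) ≡ Δ k
    sum-Δδ k = trans (sum-*ˡ q (Δ k) _) (trans (cong (Δ k *_) (sum-δ≡1 q _)) (*-identityʳ (Δ k)))

  E-col-sum : ∀ j → sumFin p (λ i → E i j) ≡ 0ℚ
  E-col-sum j = trans (sum-comm p L _) (sum-zeros L _ column-term)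
    where
    column-term : ∀ k → sumFin p (λ i → (δ (r (start ℕ.+ toℕ k)) i - δ (r (start ℕ.+ suc (toℕ k))) i)
                                       * δ (c (start ℕ.+ toℕ k)) j) ≡ 0ℚ
    column-term k = begin
      sumFin p (λ i → (δ r₁ i - δ r₂ i) * δ c₁ j) ≡⟨ sum-*ʳ p (δ c₁ j) (λ i → δ r₁ i - δ r₂ i) ⟩
      sumFin p (λ i → δ r₁ i - δ r₂ i) * δ c₁ j   ≡⟨ cong (_* δ c₁ j) (sum-sub p (δ r₁) (δ r₂)) ⟩
      (sumFin p (δ r₁) - sumFin p (δ r₂)) * δ c₁ j ≡⟨ cong (λ x → (x - sumFin p (δ r₂)) * δ c₁ j) (sum-δ≡1 p r₁) ⟩
      (1ℚ - sumFin p (δ r₂)) * δ c₁ j              ≡⟨ cong (λ x → (1ℚ - x) * δ c₁ j) (sum-δ≡1 p r₂) ⟩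
      (1ℚ - 1ℚ) * δ c₁ j                           ≡⟨ cong (_* δ c₁ j) (+-inverseʳ 1ℚ) ⟩
      0ℚ * δ c₁ j                                  ≡⟨ *-zeroˡ (δ c₁ j) ⟩
      0ℚ                                           ∎
      where
      open ≡-Reasoning
      r₁ = r (start ℕ.+ toℕ k)
      r₂ = r (start ℕ.+ suc (toℕ k))
      c₁ = c (start ℕ.+ toℕ k)

  E-supported-offGrid : ∀ i j → OnGrid (A i j) → E i j ≡ 0ℚ
  E-supported-offGrid i j on = trans (E≡sum-term i j) (sum-zeros L _ (λ k → term≡0 (start ℕ.+ toℕ k)))
    where
    term≡0 : ∀ t → term t i j ≡ 0ℚ
    term≡0 t with c t FinP.≟ j
    ... | no c≢j = trans (cong ((δ (r t) i - δ (r (suc t)) i) *_) (δ-≢ c≢j)) (*-zeroʳ (δ (r t) i - δ (r (suc t)) i))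
    ... | yes refl with r t FinP.≟ i | r (suc t) FinP.≟ i
    ...   | yes refl | _        = ⊥-elim (offGrid-rc t on)
    ...   | no _     | yes refl = ⊥-elim (offGrid-turn t on)
    ...   | no r≢i   | no r′≢i  = trans (cong₂ (λ u v → (u - v) * δ (c t) (c t)) (δ-≢ r≢i) (δ-≢ r′≢i)) (*-zeroˡ (δ (c t) (c t)))

  i* : Fin p
  i* = r (suc start)

  j* : Fin q
  j* = c start

  -- Only the first step of the cycle enters cell (i*, j*): by minimality of the repeat, row i* is
  -- visited once, and the visit that leaves it uses column c (suc start) ≠ j*.
  E-i*j*≡-1 : E i* j* ≡ - 1ℚ
  E-i*j*≡-1 = trans (E≡sum-term i* j*) (trans (sum-single L _ k₀ others) first-term)
    where
    0<L : 0 ℕ.< L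
    0<L = ℕP.m<n⇒0<n∸m start<end
    k₀ : Fin L
    k₀ = Fin.fromℕ< 0<L
    k₀≡0 : toℕ k₀ ≡ 0
    k₀≡0 = FinP.toℕ-fromℕ< 0<L
    suc-start<end : suc start ℕ.< end
    suc-start<end = ℕP.≤∧≢⇒< start<end (λ e → r-moves start (trans (cong r e) (sym r-start≡r-end)))
    first-term : term (start ℕ.+ toℕ k₀) i* j* ≡ - 1ℚ
    first-term rewrite k₀≡0 | ℕP.+-identityʳ start =
      cong₂ _*_ (cong₂ _-_ (δ-≢ (λ e → r-moves start (sym e))) (δ-refl i*)) (δ-refl j*)
    others : ∀ k → ¬ k ≡ k₀ → term (start ℕ.+ toℕ k) i* j* ≡ 0ℚ
    others k k≢k₀ with r (start ℕ.+ toℕ k) FinP.≟ i*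
    ... | yes e = trans (cong (Δ *_) (δ-≢ c≢j*)) (*-zeroʳ Δ)
      where
      Δ = δ (r (start ℕ.+ toℕ k)) i* - δ (r (suc (start ℕ.+ toℕ k))) i*
      t≡suc-start : start ℕ.+ toℕ k ≡ suc start
      t≡suc-start = r-distinct _ (suc start) (start+k<end k) suc-start<end e
      c≢j* : ¬ c (start ℕ.+ toℕ k) ≡ c start
      c≢j* e′ = c-moves start (trans (cong c (sym t≡suc-start)) e′)
    ... | no r≢i* with r (suc (start ℕ.+ toℕ k)) FinP.≟ i*
    ...   | no r′≢i* = trans (cong₂ (λ u v → (u - v) * δ (c (start ℕ.+ toℕ k)) j*) (δ-≢ r≢i*) (δ-≢ r′≢i*))
                           (*-zeroˡ (δ (c (start ℕ.+ toℕ k)) j*))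
    ...   | yes e with ℕP.m≤n⇒m<n∨m≡n (start+k<end k)
    ...     | inj₁ lt = ⊥-elim (k≢k₀ (FinP.toℕ-injective (trans (k≡0 (r-distinct _ (suc start) lt suc-start<end e)) (sym k₀≡0))))
      where
      k≡0 : suc (start ℕ.+ toℕ k) ≡ suc start → toℕ k ≡ 0
      k≡0 e′ = ℕP.+-cancelˡ-≡ start (toℕ k) 0 (trans (ℕP.suc-injective e′) (sym (ℕP.+-identityʳ start)))
    ...     | inj₂ e′ = ⊥-elim (r-moves start (sym (trans r-start≡r-end (trans (cong r (sym e′)) e))))

module Rounding (N p q : ℕ) (a : Fin p → ℚ) (b : Fin q → ℚ)
  (a-onGrid : ∀ i → Grid.OnGrid N (a i)) (b-onGrid : ∀ j → Grid.OnGrid N (b j))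
  (D : Fin p → Fin q → ℕ) where

  open Grid N
  open Transport

  sumℕ : ∀ n → (Fin n → ℕ) → ℕ
  sumℕ zero    f = 0
  sumℕ (suc n) f = f zero ℕ.+ sumℕ n (λ i → f (suc i))

  sumℕ-mono-≤ : ∀ n {f g : Fin n → ℕ} → (∀ i → f i ℕ.≤ g i) → sumℕ n f ℕ.≤ sumℕ n g
  sumℕ-mono-≤ zero    h = ℕ.z≤n
  sumℕ-mono-≤ (suc n) h = ℕP.+-mono-≤ (h zero) (sumℕ-mono-≤ n (λ i → h (suc i)))

  sumℕ-mono-< : ∀ n {f g : Fin n → ℕ} → (∀ i → f i ℕ.≤ g i) → (k : Fin n) → f k ℕ.< g k → sumℕ n f ℕ.< sumℕ n g
  sumℕ-mono-< (suc n) h zero    lt = ℕP.+-mono-<-≤ lt (sumℕ-mono-≤ n (λ i → h (suc i)))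
  sumℕ-mono-< (suc n) h (suc k) lt = ℕP.+-mono-≤-< (h zero) (sumℕ-mono-< n (λ i → h (suc i)) k lt)

  indicator : ∀ {x} → Dec (OnGrid x) → ℕ
  indicator (yes _) = 0
  indicator (no _)  = 1

  offGrid# : ℚ → ℕ
  offGrid# x = indicator (onGrid? x)

  indicator-onGrid : ∀ {x} (d : Dec (OnGrid x)) → OnGrid x → indicator d ≡ 0
  indicator-onGrid (yes _)  on = refl
  indicator-onGrid (no ¬on) on = ⊥-elim (¬on on)

  indicator-offGrid : ∀ {x} (d : Dec (OnGrid x)) → ¬ OnGrid x → indicator d ≡ 1
  indicator-offGrid (yes on) ¬on = ⊥-elim (¬on on)
  indicator-offGrid (no _)   ¬on = refl

  indicator≤1 : ∀ {x} (d : Dec (OnGrid x)) → indicator d ℕ.≤ 1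
  indicator≤1 (yes _) = ℕ.z≤n
  indicator≤1 (no _)  = ℕ.s≤s ℕ.z≤n

  offGridCells : (Fin p → Fin q → ℚ) → ℕ
  offGridCells A = sumℕ p (λ i → sumℕ q (λ j → offGrid# (A i j)))

  record Improvement (A : Fin p → Fin q → ℚ) : Set where
    field
      A′          : Fin p → Fin q → ℚ
      A′-coupling : IsCoupling p q a b A′
      cost≤       : cost p q D A′ ≤ cost p q D A
      fewer       : offGridCells A′ ℕ.< offGridCells A

  -- Move along ±E (sign chosen so that the cost does not increase) until the first cell of the cycle empties.
  module Cancel (A : Fin p → Fin q → ℚ) (A-coupling : IsCoupling p q a b A)
    (i₀ : Fin p) (j₀ : Fin q) (offGrid₀ : ¬ OnGrid (A i₀ j₀)) where

    open Cycle N p q a b a-onGrid b-onGrid A A-coupling i₀ j₀ offGrid₀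
      using (E; E-row-sum; E-col-sum; E-supported-offGrid; i*; j*; E-i*j*≡-1)

    sign : Dec (cost p q D E ≤ 0ℚ) → Σ ℚ (λ σ → σ * cost p q D E ≤ 0ℚ × ¬ σ * (- 1ℚ) ≡ 0ℚ)
    sign (yes ≤0) = 1ℚ , subst (_≤ 0ℚ) (sym (*-identityˡ (cost p q D E))) ≤0 , (λ ())
    sign (no ≰0)  = - 1ℚ , subst (_≤ 0ℚ) (neg-distribˡ-* 1ℚ (cost p q D E))
      (neg-antimono-≤ (subst (0ℚ ≤_) (sym (*-identityˡ (cost p q D E))) (<⇒≤ (≰⇒> ≰0)))) , (λ ())

    σ : ℚ
    σ = proj₁ (sign (cost p q D E ≤? 0ℚ))

    E′ : Fin p → Fin q → ℚ
    E′ i j = σ * E i j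

    cost-E′≤0 : cost p q D E′ ≤ 0ℚ
    cost-E′≤0 = subst (_≤ 0ℚ) (sym (cost-*ˡ p q D E σ)) (proj₁ (proj₂ (sign (cost p q D E ≤? 0ℚ))))

    E′-i*j*≢0 : ¬ E′ i* j* ≡ 0ℚ
    E′-i*j*≢0 e = proj₂ (proj₂ (sign (cost p q D E ≤? 0ℚ))) (trans (cong (σ *_) (sym E-i*j*≡-1)) e)

    E′-row-sum : ∀ i → sumFin q (E′ i) ≡ 0ℚ
    E′-row-sum i = sum-*ˡ-zero q σ (E-row-sum i)

    E′-col-sum : ∀ j → sumFin p (λ i → E′ i j) ≡ 0ℚ
    E′-col-sum j = sum-*ˡ-zero p σ (E-col-sum j)

    E′-onGrid : ∀ i j → OnGrid (A i j) → E′ i j ≡ 0ℚ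
    E′-onGrid i j on = trans (cong (σ *_) (E-supported-offGrid i j on)) (*-zeroʳ σ)

    NegativeCell : Fin p × Fin q → Set
    NegativeCell (i , j) = E′ i j < 0ℚ

    -- The row of (i*, j*) sums to zero, so if E′ i* j* is positive another entry is negative.
    negativeCell : Σ (Fin p × Fin q) NegativeCell
    negativeCell = by-sign (<-cmp (E′ i* j*) 0ℚ)
      where
      in-row : 0ℚ < E′ i* j* → Dec (Σ (Fin q) (λ j → E′ i* j < 0ℚ)) → Σ (Fin p × Fin q) NegativeCell
      in-row gt (yes (j , lt)) = (i* , j) , lt
      in-row gt (no none) = ⊥-elim (<-irrefl refl (<-≤-trans gt (subst (E′ i* j* ≤_) (E′-row-sum i*)
                              (term≤sum q (E′ i*) (λ j → ≮⇒≥ (λ lt → none (j , lt))) j*))))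
      by-sign : Tri (E′ i* j* < 0ℚ) (E′ i* j* ≡ 0ℚ) (E′ i* j* > 0ℚ) → Σ (Fin p × Fin q) NegativeCell
      by-sign (tri< lt _ _) = (i* , j*) , lt
      by-sign (tri≈ _ e _)  = ⊥-elim (E′-i*j*≢0 e)
      by-sign (tri> _ _ gt) = in-row gt (FinP.any? (λ j → E′ i* j <? 0ℚ))

    cells : List (Fin p × Fin q)
    cells = cartesianProduct (allFin p) (allFin q)

    ∈-cells : ∀ i j → (i , j) ∈ cells
    ∈-cells i j = ∈-cartesianProduct⁺ (∈-allFin i) (∈-allFin j)

    ratio : Fin p × Fin q → ℚ
    ratio (i , j) = A i j * recip (- E′ i j)

    minimal : Σ (Fin p × Fin q) (λ y → NegativeCell y × (∀ z → z ∈ cells → NegativeCell z → ratio y ≤ ratio z))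
    minimal = ListMin.argmin NegativeCell (λ { (i , j) → E′ i j <? 0ℚ }) ratio cells
                (lose (∈-cells _ _) (proj₂ negativeCell))

    i₁ : Fin p
    i₁ = proj₁ (proj₁ minimal)
    j₁ : Fin q
    j₁ = proj₂ (proj₁ minimal)

    E′-i₁j₁<0 : E′ i₁ j₁ < 0ℚ
    E′-i₁j₁<0 = proj₁ (proj₂ minimal)

    t : ℚ
    t = ratio (i₁ , j₁)

    0<-E′ : ∀ {i j} → E′ i j < 0ℚ → 0ℚ < - E′ i j
    0<-E′ = neg-antimono-<

    0≤t : 0ℚ ≤ t
    0≤t = *-nonNeg (proj₁ A-coupling i₁ j₁) (<⇒≤ (recip-pos _ (0<-E′ E′-i₁j₁<0)))

    A′ : Fin p → Fin q → ℚ
    A′ i j = A i j + t * E′ i j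

    t*-E′≤A : ∀ i j → E′ i j < 0ℚ → t * (- E′ i j) ≤ A i j
    t*-E′≤A i j lt = subst (t * (- E′ i j) ≤_) ratio*-E′≡A
      (*-monoʳ-≤-nonNeg (- E′ i j) {{nonNegative (<⇒≤ (0<-E′ lt))}} (proj₂ (proj₂ minimal) (i , j) (∈-cells i j) lt))
      where
      ratio*-E′≡A : ratio (i , j) * (- E′ i j) ≡ A i j
      ratio*-E′≡A = trans (*-assoc (A i j) _ _)
        (trans (cong (A i j *_) (*-recipˡ _ (0<p⇒p≢0 (0<-E′ lt)))) (*-identityʳ (A i j)))

    0≤A′ : ∀ i j → 0ℚ ≤ A′ i j
    0≤A′ i j = by-sign (E′ i j <? 0ℚ)
      where
      by-sign : Dec (E′ i j < 0ℚ) → 0ℚ ≤ A′ i j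
      by-sign (no ≮0) = +-nonNeg (proj₁ A-coupling i j) (*-nonNeg 0≤t (≮⇒≥ ≮0))
      by-sign (yes lt) = subst (0ℚ ≤_) (solve 3 (λ a t e → a :- t :* (:- e) := a :+ t :* e) refl (A i j) t (E′ i j))
                           (p≤q⇒0≤q-p (t*-E′≤A i j lt))

    A′-coupling : IsCoupling p q a b A′
    A′-coupling = IsCoupling-+ A (λ i j → t * E′ i j) A-coupling
      (λ i → sum-*ˡ-zero q t (E′-row-sum i)) (λ j → sum-*ˡ-zero p t (E′-col-sum j)) 0≤A′

    cost≤ : cost p q D A′ ≤ cost p q D A
    cost≤ = begin
      cost p q D A′                                   ≡⟨ cost-+ p q D A (λ i j → t * E′ i j) ⟩
      cost p q D A + cost p q D (λ i j → t * E′ i j) ≡⟨ cong (λ x → cost p q D A + x) (cost-*ˡ p q D E′ t) ⟩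
      cost p q D A + t * cost p q D E′                ≤⟨ +-monoʳ-≤ (cost p q D A) (*-monoˡ-≤-0≤ 0≤t cost-E′≤0) ⟩
      cost p q D A + t * 0ℚ                           ≡⟨ cong (λ x → cost p q D A + x) (*-zeroʳ t) ⟩
      cost p q D A + 0ℚ                               ≡⟨ +-identityʳ (cost p q D A) ⟩
      cost p q D A                                    ∎
      where open ≤-Reasoning

    A′-i₁j₁≡0 : A′ i₁ j₁ ≡ 0ℚ
    A′-i₁j₁≡0 = begin
      A i₁ j₁ + (A i₁ j₁ * recip (- E′ i₁ j₁)) * E′ i₁ j₁
        ≡⟨ solve 3 (λ a r e → a :+ (a :* r) :* e := a :- a :* (r :* (:- e))) refl (A i₁ j₁) (recip (- E′ i₁ j₁)) (E′ i₁ j₁) ⟩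
      A i₁ j₁ - A i₁ j₁ * (recip (- E′ i₁ j₁) * (- E′ i₁ j₁))
        ≡⟨ cong (λ x → A i₁ j₁ - A i₁ j₁ * x) (*-recipˡ _ (0<p⇒p≢0 (0<-E′ E′-i₁j₁<0))) ⟩
      A i₁ j₁ - A i₁ j₁ * 1ℚ ≡⟨ cong (λ x → A i₁ j₁ - x) (*-identityʳ (A i₁ j₁)) ⟩
      A i₁ j₁ - A i₁ j₁      ≡⟨ +-inverseʳ (A i₁ j₁) ⟩
      0ℚ                     ∎
      where open ≡-Reasoning

    offGrid#-mono : ∀ i j → offGrid# (A′ i j) ℕ.≤ offGrid# (A i j)
    offGrid#-mono i j = by-cases (onGrid? (A i j))
      where
      by-cases : (d : Dec (OnGrid (A i j))) → offGrid# (A′ i j) ℕ.≤ indicator d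
      by-cases (yes on) = ℕP.≤-reflexive (trans (cong offGrid# A′≡A) (indicator-onGrid (onGrid? (A i j)) on))
        where
        A′≡A : A′ i j ≡ A i j
        A′≡A = trans (cong (λ x → A i j + t * x) (E′-onGrid i j on))
                 (trans (cong (λ x → A i j + x) (*-zeroʳ t)) (+-identityʳ (A i j)))
      by-cases (no ¬on) = indicator≤1 (onGrid? (A′ i j))

    offGrid#-drops : offGrid# (A′ i₁ j₁) ℕ.< offGrid# (A i₁ j₁)
    offGrid#-drops = subst₂ ℕ._<_
      (sym (trans (cong offGrid# A′-i₁j₁≡0) (indicator-onGrid (onGrid? 0ℚ) OnGrid-0)))
      (sym (indicator-offGrid (onGrid? (A i₁ j₁)) (λ on → <⇒≢ E′-i₁j₁<0 (E′-onGrid i₁ j₁ on)))) (ℕ.s≤s ℕ.z≤n)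

    improvement : Improvement A
    improvement = record
      { A′ = A′ ; A′-coupling = A′-coupling ; cost≤ = cost≤
      ; fewer = sumℕ-mono-< p (λ i → sumℕ-mono-≤ q (offGrid#-mono i)) i₁
                  (sumℕ-mono-< q (offGrid#-mono i₁) j₁ offGrid#-drops) }

  OnGridBelow : (Fin p → Fin q → ℚ) → Set
  OnGridBelow A = Σ (Fin p → Fin q → ℚ) (λ B →
    IsCoupling p q a b B × (∀ i j → OnGrid (B i j)) × cost p q D B ≤ cost p q D A)

  roundWithin : ∀ fuel (A : Fin p → Fin q → ℚ) → offGridCells A ℕ.≤ fuel → IsCoupling p q a b A → OnGridBelow A
  roundWithin fuel A bound A-coupling = by-cases (FinP.all? (λ i → FinP.all? (λ j → onGrid? (A i j))))
    where
    by-cases : Dec (∀ i j → OnGrid (A i j)) → OnGridBelow A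
    by-cases (yes onGrid) = A , A-coupling , onGrid , ≤-refl
    by-cases (no ¬onGrid) = continue fuel bound
      where
      offRow = FinP.¬∀⟶∃¬ p _ (λ i → FinP.all? (λ j → onGrid? (A i j))) ¬onGrid
      offCell = FinP.¬∀⟶∃¬ q _ (λ j → onGrid? (A (proj₁ offRow) j)) (proj₂ offRow)
      improved : Improvement A
      improved = Cancel.improvement A A-coupling (proj₁ offRow) (proj₁ offCell) (proj₂ offCell)
      open Improvement improved
      continue : ∀ fuel → offGridCells A ℕ.≤ fuel → OnGridBelow A
      continue zero    bound′ = ⊥-elim (ℕP.n≮0 (ℕP.<-≤-trans fewer bound′))
      continue (suc f) bound′ = B , B-coupling , B-onGrid , ≤-trans B≤A′ cost≤
        where
        rounded = roundWithin f A′ (ℕP.<⇒≤pred (ℕP.<-≤-trans fewer bound′)) A′-coupling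
        B = proj₁ rounded
        B-coupling = proj₁ (proj₂ rounded)
        B-onGrid = proj₁ (proj₂ (proj₂ rounded))
        B≤A′ = proj₂ (proj₂ (proj₂ rounded))

  roundCoupling : ∀ A → IsCoupling p q a b A → OnGridBelow A
  roundCoupling A = roundWithin (offGridCells A) A ℕP.≤-refl

allVecs : ∀ {X : Set} n → List X → List (Vec X n)
allVecs zero    xs = Vec.[] ∷ []
allVecs (suc n) xs = map (λ (x , v) → x Vec.∷ v) (cartesianProduct xs (allVecs n xs))

∈-allVecs : ∀ {X : Set} n (xs : List X) → (∀ x → x ∈ xs) → ∀ v → v ∈ allVecs n xs
∈-allVecs zero    xs all Vec.[]       = here refl
∈-allVecs (suc n) xs all (x Vec.∷ v) =
  ∈-map⁺ (λ (x , v) → x Vec.∷ v) (∈-cartesianProduct⁺ (all x) (∈-allVecs n xs all v))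

-- Rounding moves every coupling onto the grid without raising its cost, and there are only finitely many
-- grid couplings, so the cheapest of those attains the infimum.
module OptimalCoupling (N₀ p q : ℕ) (a : Fin p → ℚ) (b : Fin q → ℚ) (D : Fin p → Fin q → ℕ)
  (a≤1 : ∀ i → a i ≤ 1ℚ) (a-onGrid : ∀ i → Grid.OnGrid (suc N₀) (a i)) (b-onGrid : ∀ j → Grid.OnGrid (suc N₀) (b j)) where

  open Transport

  N = suc N₀
  open Grid N
  open Rounding N p q a b a-onGrid b-onGrid D using (roundCoupling)

  Nq = ℕ→ℚ N

  Matrix : Set
  Matrix = Vec (Vec (Fin (suc N)) q) p

  toℚ-matrix : Matrix → Fin p → Fin q → ℚ
  toℚ-matrix M i j = ℕ→ℚ (toℕ (Vec.lookup (Vec.lookup M i) j)) * recip Nq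

  matrices : List Matrix
  matrices = allVecs p (allVecs q (allFin (suc N)))

  ∈-matrices : ∀ M → M ∈ matrices
  ∈-matrices = ∈-allVecs p _ (∈-allVecs q _ ∈-allFin)

  Admissible : Matrix → Set
  Admissible M = IsCoupling p q a b (toℚ-matrix M)

  module AsMatrix (B : Fin p → Fin q → ℚ) (B-coupling : IsCoupling p q a b B) (B-onGrid : ∀ i j → OnGrid (B i j)) where

    z : ∀ i j → ℤ
    z i j = OnGrid.scaled (B-onGrid i j)

    B≤1 : ∀ i j → B i j ≤ 1ℚ
    B≤1 i j = ≤-trans (subst (B i j ≤_) (proj₁ (proj₂ B-coupling) i) (term≤sum q (B i) (proj₁ B-coupling i) j)) (a≤1 i)

    0≤z : ∀ i j → + 0 ℤ.≤ z i j
    0≤z i j = ℤ→ℚ-cancel-≤ (subst (0ℚ ≤_) (OnGrid.scaled≡ (B-onGrid i j)) (*-nonNeg (proj₁ B-coupling i j) (0≤ℕ→ℚ N)))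

    z≤N : ∀ i j → z i j ℤ.≤ + N
    z≤N i j = ℤ→ℚ-cancel-≤ (subst₂ _≤_ (OnGrid.scaled≡ (B-onGrid i j)) (*-identityˡ Nq)
                (*-monoʳ-≤-nonNeg Nq {{nonNegative (0≤ℕ→ℚ N)}} (B≤1 i j)))

    +∣z∣≡z : ∀ i j → + ℤ.∣ z i j ∣ ≡ z i j
    +∣z∣≡z i j = ℤP.0≤i⇒+∣i∣≡i (0≤z i j)

    ∣z∣<1+N : ∀ i j → ℤ.∣ z i j ∣ ℕ.< suc N
    ∣z∣<1+N i j = ℕ.s≤s (ℤP.drop‿+≤+ (subst (ℤ._≤ + N) (sym (+∣z∣≡z i j)) (z≤N i j)))

    M : Matrix
    M = Vec.tabulate (λ i → Vec.tabulate (λ j → Fin.fromℕ< (∣z∣<1+N i j)))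

    M≡B : ∀ i j → toℚ-matrix M i j ≡ B i j
    M≡B i j = begin
      ℕ→ℚ (toℕ (Vec.lookup (Vec.lookup M i) j)) * recip Nq
        ≡⟨ cong (λ x → ℕ→ℚ (toℕ x) * recip Nq)
             (trans (cong (λ v → Vec.lookup v j) (VecP.lookup∘tabulate _ i)) (VecP.lookup∘tabulate _ j)) ⟩
      ℕ→ℚ (toℕ (Fin.fromℕ< (∣z∣<1+N i j))) * recip Nq ≡⟨ cong (λ x → ℕ→ℚ x * recip Nq) (FinP.toℕ-fromℕ< (∣z∣<1+N i j)) ⟩
      ℤ→ℚ (+ ℤ.∣ z i j ∣) * recip Nq                  ≡⟨ cong (λ x → ℤ→ℚ x * recip Nq) (+∣z∣≡z i j) ⟩
      ℤ→ℚ (z i j) * recip Nq                         ≡⟨ cong (_* recip Nq) (sym (OnGrid.scaled≡ (B-onGrid i j))) ⟩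
      B i j * Nq * recip Nq                          ≡⟨ *-assoc (B i j) Nq (recip Nq) ⟩
      B i j * (Nq * recip Nq)                        ≡⟨ cong (B i j *_) (*-recipʳ Nq (0<p⇒p≢0 (0<ℕ→ℚ-suc N₀))) ⟩
      B i j * 1ℚ                                     ≡⟨ *-identityʳ (B i j) ⟩
      B i j                                          ∎
      where open ≡-Reasoning

    admissible : Admissible M
    admissible = IsCoupling-cong (λ i j → sym (M≡B i j)) B-coupling

    cost-M : cost p q D (toℚ-matrix M) ≡ cost p q D B
    cost-M = cost-cong {p} {q} {D} M≡B

  module Rounded (A : Fin p → Fin q → ℚ) (A-coupling : IsCoupling p q a b A) where
    rounded = roundCoupling A A-coupling
    open AsMatrix (proj₁ rounded) (proj₁ (proj₂ rounded)) (proj₁ (proj₂ (proj₂ rounded))) public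

    cost-M≤ : cost p q D (toℚ-matrix M) ≤ cost p q D A
    cost-M≤ = subst (_≤ cost p q D A) (sym cost-M) (proj₂ (proj₂ (proj₂ rounded)))

  infCost-exists : (A₀ : Fin p → Fin q → ℚ) → IsCoupling p q a b A₀ → Σ ℚ (IsInfCost p q a b D)
  infCost-exists A₀ A₀-coupling = w , w≤cost , w-approx
    where
    cheapest : Σ Matrix (λ M → Admissible M × (∀ M′ → M′ ∈ matrices → Admissible M′ →
                 cost p q D (toℚ-matrix M) ≤ cost p q D (toℚ-matrix M′)))
    cheapest = ListMin.argmin Admissible (λ M → isCoupling? p q a b (toℚ-matrix M)) (λ M → cost p q D (toℚ-matrix M))
                 matrices (lose (∈-matrices (Rounded.M A₀ A₀-coupling)) (Rounded.admissible A₀ A₀-coupling))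

    w : ℚ
    w = cost p q D (toℚ-matrix (proj₁ cheapest))

    w≤cost : ∀ A → IsCoupling p q a b A → w ≤ cost p q D A
    w≤cost A A-coupling = ≤-trans (proj₂ (proj₂ cheapest) M (∈-matrices M) admissible) cost-M≤
      where open Rounded A A-coupling

    w-approx : ∀ ε → Positive ε → Σ _ (λ A → IsCoupling p q a b A × cost p q D A < w + ε)
    w-approx ε ε>0 = toℚ-matrix (proj₁ cheapest) , proj₁ (proj₂ cheapest) ,
      subst (_< w + ε) (+-identityʳ w) (+-monoʳ-< w (positive⁻¹ ε {{ε>0}}))

module LazyMass where

  open Transport
  open Grid

  1/suc : ℕ → ℚ
  1/suc k = + 1 / suc k

  0≤1/suc : ∀ k → 0ℚ ≤ 1/suc k
  0≤1/suc k = nonNegative⁻¹ _ {{normalize-nonNeg 1 (suc k)}}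

  0<1/suc : ∀ k → 0ℚ < 1/suc k
  0<1/suc k = positive⁻¹ _ {{normalize-pos 1 (suc k)}}

  1/suc≤1 : ∀ k → 1/suc k ≤ 1ℚ
  1/suc≤1 k = subst₂ _≤_ (*-identityʳ (1/suc k)) ([1/1+k]*[1+k]≡1 k)
    (*-monoˡ-≤-0≤ (0≤1/suc k) (ℕ→ℚ-mono-≤ {1} {suc k} (ℕ.s≤s ℕ.z≤n)))

  sum-mass≡1 : ∀ α k → sumFin (suc (suc k)) (mass α (suc k)) ≡ 1ℚ
  sum-mass≡1 α k = begin
    α + sumFin (suc k) (λ _ → (1ℚ - α) * 1/suc k)   ≡⟨ cong (λ x → α + x) (sum-const (suc k) _) ⟩
    α + ℕ→ℚ (suc k) * ((1ℚ - α) * 1/suc k)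
      ≡⟨ solve 3 (λ a n i → a :+ n :* ((con 1ℚ :- a) :* i) := a :+ (con 1ℚ :- a) :* (i :* n)) refl α (ℕ→ℚ (suc k)) (1/suc k) ⟩
    α + (1ℚ - α) * (1/suc k * ℕ→ℚ (suc k))          ≡⟨ cong (λ x → α + (1ℚ - α) * x) ([1/1+k]*[1+k]≡1 k) ⟩
    α + (1ℚ - α) * 1ℚ                               ≡⟨ solve 1 (λ a → a :+ (con 1ℚ :- a) :* con 1ℚ := con 1ℚ) refl α ⟩
    1ℚ                                              ∎
    where open ≡-Reasoning

  0≤mass : ∀ α k → 0ℚ ≤ α → α ≤ 1ℚ → ∀ i → 0ℚ ≤ mass α (suc k) i
  0≤mass α k 0≤α α≤1 zero    = 0≤α
  0≤mass α k 0≤α α≤1 (suc i) = *-nonNeg (p≤q⇒0≤q-p α≤1) (0≤1/suc k)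

  mass≤1 : ∀ α k → 0ℚ ≤ α → α ≤ 1ℚ → ∀ i → mass α (suc k) i ≤ 1ℚ
  mass≤1 α k 0≤α α≤1 zero    = α≤1
  mass≤1 α k 0≤α α≤1 (suc i) = ≤-trans (*-monoʳ-≤-nonNeg (1/suc k) {{nonNegative (0≤1/suc k)}} 1-α≤1)
    (subst (_≤ 1ℚ) (sym (*-identityˡ (1/suc k))) (1/suc≤1 k))
    where
    1-α≤1 : 1ℚ - α ≤ 1ℚ
    1-α≤1 = 0≤q-p⇒p≤q (subst (0ℚ ≤_) (solve 1 (λ a → a := con 1ℚ :- (con 1ℚ :- a)) refl α) 0≤α)

  -- With N = ↧α · (k + 1), the masses α and (1 - α)/(k + 1) both lie on (1/N)ℤ, and the
  -- independent coupling m ⊗ m shows that the transport problem is feasible.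
  lazyInfCost-exists : ∀ k α → 0ℚ ≤ α → α ≤ 1ℚ → (D : Fin (suc (suc k)) → Fin (suc (suc k)) → ℕ) →
    Σ ℚ (IsInfCost (suc (suc k)) (suc (suc k)) (mass α (suc k)) (mass α (suc k)) D)
  lazyInfCost-exists k α 0≤α α≤1 D =
    OptimalCoupling.infCost-exists N₀ _ _ m m D (mass≤1 α k 0≤α α≤1) onGrid onGrid (λ i j → m i * m j) independent
    where
    d = ℚ.denominator-1 α
    N₀ = k ℕ.+ d ℕ.* suc k
    N = suc N₀
    m = mass α (suc k)
    N≡ : ℕ→ℚ N ≡ ℕ→ℚ (suc d) * ℕ→ℚ (suc k)
    N≡ = ℕ→ℚ-homo-* (suc d) (suc k)
    onGrid : ∀ i → OnGrid N (m i)
    onGrid zero = (↥ α ℤ.* + suc k) , (begin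
      α * ℕ→ℚ N                                ≡⟨ cong (α *_) N≡ ⟩
      α * (ℕ→ℚ (suc d) * ℕ→ℚ (suc k))          ≡⟨ sym (*-assoc α _ _) ⟩
      α * ℕ→ℚ (suc d) * ℕ→ℚ (suc k)            ≡⟨ cong (_* ℕ→ℚ (suc k)) (p*↧p≡↥p α) ⟩
      ℤ→ℚ (↥ α) * ℤ→ℚ (+ suc k)                ≡⟨ sym (ℤ→ℚ-homo-* (↥ α) (+ suc k)) ⟩
      ℤ→ℚ (↥ α ℤ.* + suc k)                    ∎)
      where open ≡-Reasoning
    onGrid (suc i) = (+ suc d ℤ.- ↥ α) , (begin
      (1ℚ - α) * 1/suc k * ℕ→ℚ N                        ≡⟨ cong ((1ℚ - α) * 1/suc k *_) N≡ ⟩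
      (1ℚ - α) * 1/suc k * (ℕ→ℚ (suc d) * ℕ→ℚ (suc k))
        ≡⟨ solve 4 (λ a i d n → (con 1ℚ :- a) :* i :* (d :* n) := (d :- a :* d) :* (i :* n)) refl α (1/suc k) (ℕ→ℚ (suc d)) (ℕ→ℚ (suc k)) ⟩
      (ℕ→ℚ (suc d) - α * ℕ→ℚ (suc d)) * (1/suc k * ℕ→ℚ (suc k))
        ≡⟨ cong₂ (λ x y → (ℕ→ℚ (suc d) - x) * y) (p*↧p≡↥p α) ([1/1+k]*[1+k]≡1 k) ⟩
      (ℤ→ℚ (+ suc d) - ℤ→ℚ (↥ α)) * 1ℚ                   ≡⟨ *-identityʳ _ ⟩
      ℤ→ℚ (+ suc d) + - ℤ→ℚ (↥ α)                        ≡⟨ cong (λ x → ℤ→ℚ (+ suc d) + x) (sym (ℤ→ℚ-homo‿- (↥ α))) ⟩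
      ℤ→ℚ (+ suc d) + ℤ→ℚ (ℤ.- ↥ α)                      ≡⟨ sym (ℤ→ℚ-homo-+ (+ suc d) (ℤ.- ↥ α)) ⟩
      ℤ→ℚ (+ suc d ℤ.- ↥ α)                              ∎)
      where open ≡-Reasoning
    independent : IsCoupling (suc (suc k)) (suc (suc k)) m m (λ i j → m i * m j)
    independent =
      (λ i j → *-nonNeg (0≤mass α k 0≤α α≤1 i) (0≤mass α k 0≤α α≤1 j)) ,
      (λ i → trans (sum-*ˡ (suc (suc k)) (m i) m) (trans (cong (m i *_) (sum-mass≡1 α k)) (*-identityʳ (m i)))) ,
      (λ j → trans (sum-*ʳ (suc (suc k)) (m j) m) (trans (cong (_* m j) (sum-mass≡1 α k)) (*-identityˡ (m j))))

module Pushforward {P Q p q : ℕ} (φ : Fin P → Fin p) (ψ : Fin Q → Fin q) (A : Fin P → Fin Q → ℚ) where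

  term : Fin p → Fin q → Fin P → Fin Q → ℚ
  term i j s t = δ (φ s) i * (δ (ψ t) j * A s t)

  B : Fin p → Fin q → ℚ
  B i j = sumFin P (λ s → sumFin Q (λ t → term i j s t))

  0≤B : (∀ s t → 0ℚ ≤ A s t) → ∀ i j → 0ℚ ≤ B i j
  0≤B 0≤A i j = 0≤sum P (λ s → 0≤sum Q (λ t → *-nonNeg (0≤δ (φ s) i) (*-nonNeg (0≤δ (ψ t) j) (0≤A s t))))

  B-row-sum : ∀ i → sumFin q (B i) ≡ sumFin P (λ s → δ (φ s) i * sumFin Q (A s))
  B-row-sum i = begin
    sumFin q (B i)                                                    ≡⟨ sum-comm q P _ ⟩
    sumFin P (λ s → sumFin q (λ j → sumFin Q (λ t → term i j s t)))   ≡⟨ sum-cong P (λ s → sum-comm q Q _) ⟩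
    sumFin P (λ s → sumFin Q (λ t → sumFin q (λ j → term i j s t)))   ≡⟨ sum-cong P (λ s → sum-cong Q (λ t → collapse s t)) ⟩
    sumFin P (λ s → sumFin Q (λ t → δ (φ s) i * A s t))               ≡⟨ sum-cong P (λ s → sum-*ˡ Q (δ (φ s) i) (A s)) ⟩
    sumFin P (λ s → δ (φ s) i * sumFin Q (A s))                       ∎
    where
    open ≡-Reasoning
    collapse : ∀ s t → sumFin q (λ j → term i j s t) ≡ δ (φ s) i * A s t
    collapse s t = trans (sum-*ˡ q (δ (φ s) i) _) (cong (δ (φ s) i *_)
      (trans (sum-*ʳ q (A s t) (δ (ψ t))) (trans (cong (_* A s t) (sum-δ≡1 q (ψ t))) (*-identityˡ (A s t)))))

  B-col-sum : ∀ j → sumFin p (λ i → B i j) ≡ sumFin Q (λ t → δ (ψ t) j * sumFin P (λ s → A s t))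
  B-col-sum j = begin
    sumFin p (λ i → B i j)                                            ≡⟨ sum-comm p P _ ⟩
    sumFin P (λ s → sumFin p (λ i → sumFin Q (λ t → term i j s t)))   ≡⟨ sum-cong P (λ s → sum-comm p Q _) ⟩
    sumFin P (λ s → sumFin Q (λ t → sumFin p (λ i → term i j s t)))   ≡⟨ sum-cong P (λ s → sum-cong Q (λ t → collapse s t)) ⟩
    sumFin P (λ s → sumFin Q (λ t → δ (ψ t) j * A s t))               ≡⟨ sum-comm P Q _ ⟩
    sumFin Q (λ t → sumFin P (λ s → δ (ψ t) j * A s t))               ≡⟨ sum-cong Q (λ t → sum-*ˡ P (δ (ψ t) j) (λ s → A s t)) ⟩
    sumFin Q (λ t → δ (ψ t) j * sumFin P (λ s → A s t))               ∎
    where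
    open ≡-Reasoning
    collapse : ∀ s t → sumFin p (λ i → term i j s t) ≡ δ (ψ t) j * A s t
    collapse s t = trans (sum-*ʳ p (δ (ψ t) j * A s t) (δ (φ s)))
      (trans (cong (_* (δ (ψ t) j * A s t)) (sum-δ≡1 p (φ s))) (*-identityˡ _))

  B-cost : ∀ (g : Fin p → Fin q → ℚ) →
    sumFin p (λ i → sumFin q (λ j → B i j * g i j)) ≡ sumFin P (λ s → sumFin Q (λ t → A s t * g (φ s) (ψ t)))
  B-cost g = begin
    sumFin p (λ i → sumFin q (λ j → B i j * g i j))
      ≡⟨ sum-cong p (λ i → sum-cong q (λ j → trans (sym (sum-*ʳ P (g i j) _)) (sum-cong P (λ s → sym (sum-*ʳ Q (g i j) _))))) ⟩
    sumFin p (λ i → sumFin q (λ j → sumFin P (λ s → sumFin Q (λ t → term i j s t * g i j))))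
      ≡⟨ sum-cong p (λ i → sum-comm q P _) ⟩
    sumFin p (λ i → sumFin P (λ s → sumFin q (λ j → sumFin Q (λ t → term i j s t * g i j))))
      ≡⟨ sum-comm p P _ ⟩
    sumFin P (λ s → sumFin p (λ i → sumFin q (λ j → sumFin Q (λ t → term i j s t * g i j))))
      ≡⟨ sum-cong P (λ s → sum-cong p (λ i → sum-comm q Q _)) ⟩
    sumFin P (λ s → sumFin p (λ i → sumFin Q (λ t → sumFin q (λ j → term i j s t * g i j))))
      ≡⟨ sum-cong P (λ s → sum-comm p Q _) ⟩
    sumFin P (λ s → sumFin Q (λ t → sumFin p (λ i → sumFin q (λ j → term i j s t * g i j))))
      ≡⟨ sum-cong P (λ s → sum-cong Q (λ t → collapse s t)) ⟩
    sumFin P (λ s → sumFin Q (λ t → A s t * g (φ s) (ψ t))) ∎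
    where
    open ≡-Reasoning
    collapse : ∀ s t → sumFin p (λ i → sumFin q (λ j → term i j s t * g i j)) ≡ A s t * g (φ s) (ψ t)
    collapse s t = begin
      sumFin p (λ i → sumFin q (λ j → term i j s t * g i j))
        ≡⟨ sum-cong p (λ i → sum-cong q (λ j → solve 4 (λ x y a h → x :* (y :* a) :* h := x :* (y :* (a :* h))) refl
             (δ (φ s) i) (δ (ψ t) j) (A s t) (g i j))) ⟩
      sumFin p (λ i → sumFin q (λ j → δ (φ s) i * (δ (ψ t) j * (A s t * g i j))))
        ≡⟨ sum-cong p (λ i → trans (sum-*ˡ q (δ (φ s) i) _) (cong (δ (φ s) i *_) (sum-δˡ q (ψ t) (λ j → A s t * g i j)))) ⟩
      sumFin p (λ i → δ (φ s) i * (A s t * g i (ψ t))) ≡⟨ sum-δˡ p (φ s) (λ i → A s t * g i (ψ t)) ⟩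
      A s t * g (φ s) (ψ t) ∎

-- Indexing of the support x ∷ Γ(x) of a product vertex of degree L whose factor vertex has degree n:
-- inj₁ indexes the support of the factor vertex, inj₂ the m neighbours along the other factor, all of
-- which project onto the centre.
record SupportSplit (L n m : ℕ) : Set where
  field
    split          : Fin (suc L) → Fin (suc n) ⊎ Fin m
    unsplit        : Fin (suc n) ⊎ Fin m → Fin (suc L)
    unsplit-split  : ∀ s → unsplit (split s) ≡ s
    split-unsplit  : ∀ x → split (unsplit x) ≡ x
    unsplit-centre : unsplit (inj₁ zero) ≡ zero

  sum-split : ∀ (h : Fin (suc n) ⊎ Fin m → ℚ) →
    sumFin (suc L) (λ s → h (split s)) ≡ sumFin (suc n) (λ i → h (inj₁ i)) + sumFin m (λ k → h (inj₂ k))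
  sum-split h = trans (sum-⊎ (suc L) (suc n) m split unsplit unsplit-split split-unsplit (λ s → h (split s)))
    (cong₂ _+_ (sum-cong (suc n) (λ i → cong h (split-unsplit (inj₁ i)))) (sum-cong m (λ k → cong h (split-unsplit (inj₂ k)))))

  split-suc≢centre : ∀ s → ¬ split (suc s) ≡ inj₁ zero
  split-suc≢centre s e with trans (sym (unsplit-split (suc s))) (trans (cong unsplit e) unsplit-centre)
  ... | ()

  split-centre : split zero ≡ inj₁ zero
  split-centre = trans (cong split (sym unsplit-centre)) (split-unsplit (inj₁ zero))

toFactor : ∀ {n m} → Fin (suc n) ⊎ Fin m → Fin (suc n)
toFactor (inj₁ i) = i
toFactor (inj₂ _) = zero

record EdgeDistances {L₁ L₂ n₁ n₂ m} (X : SupportSplit L₁ n₁ m) (Y : SupportSplit L₂ n₂ m)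
                     (D : Fin (suc L₁) → Fin (suc L₂) → ℕ) : Set where
  private
    module X = SupportSplit X
    module Y = SupportSplit Y
  field
    projection≤ : ∀ s t → D (X.unsplit (inj₁ (toFactor (X.split s)))) (Y.unsplit (inj₁ (toFactor (Y.split t)))) ℕ.≤ D s t
    parallel≤1  : ∀ k → D (X.unsplit (inj₂ k)) (Y.unsplit (inj₂ k)) ℕ.≤ 1
    edge≡1      : D zero zero ≡ 1

module ProductEdge (n₀ m : ℕ) (X Y : SupportSplit (suc (n₀ ℕ.+ m)) (suc n₀) m)
  (D : Fin (suc (suc (n₀ ℕ.+ m))) → Fin (suc (suc (n₀ ℕ.+ m))) → ℕ) (edge : EdgeDistances X Y D)
  (ε : ℚ) (0<ε : 0ℚ < ε) (δ₀ : ℚ)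
  (factor-flat : ∀ α → 0ℚ ≤ α → 1ℚ - δ₀ < α → α < 1ℚ →
     ∀ w → Transport.IsInfCost (suc (suc n₀)) (suc (suc n₀)) (mass α (suc n₀)) (mass α (suc n₀))
             (λ i j → D (SupportSplit.unsplit X (inj₁ i)) (SupportSplit.unsplit Y (inj₁ j))) w →
     ∣ ℕ→ℚ (D (SupportSplit.unsplit X (inj₁ zero)) (SupportSplit.unsplit Y (inj₁ zero))) - w ∣
       < ε * (1ℚ - α) * ℕ→ℚ (D (SupportSplit.unsplit X (inj₁ zero)) (SupportSplit.unsplit Y (inj₁ zero))))
  (β : ℚ) (0≤β : 0ℚ ≤ β) (1-δ₀<β : 1ℚ - δ₀ < β) (β<1 : β < 1ℚ)
  (w : ℚ) (w-inf : Transport.IsInfCost (suc (suc (n₀ ℕ.+ m))) (suc (suc (n₀ ℕ.+ m)))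
                     (mass β (suc (n₀ ℕ.+ m))) (mass β (suc (n₀ ℕ.+ m))) D w) where

  open Transport
  open LazyMass
  open EdgeDistances edge
  module X = SupportSplit X
  module Y = SupportSplit Y

  n L : ℕ
  n = suc n₀
  L = suc (n₀ ℕ.+ m)

  Dᶠ : Fin (suc n) → Fin (suc n) → ℕ
  Dᶠ i j = D (X.unsplit (inj₁ i)) (Y.unsplit (inj₁ j))

  Dᶠ-edge : Dᶠ zero zero ≡ 1
  Dᶠ-edge = trans (cong₂ D X.unsplit-centre Y.unsplit-centre) edge≡1

  nq mq : ℚ
  nq = ℕ→ℚ n
  mq = ℕ→ℚ m

  u : ℚ
  u = (1ℚ - β) * 1/suc (n₀ ℕ.+ m)

  0<u : 0ℚ < u
  0<u = *-pos (p<q⇒0<q-p β<1) (0<1/suc (n₀ ℕ.+ m))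

  0≤u : 0ℚ ≤ u
  0≤u = <⇒≤ 0<u

  L*u≡1-β : ℕ→ℚ L * u ≡ 1ℚ - β
  L*u≡1-β = begin
    ℕ→ℚ L * ((1ℚ - β) * 1/suc (n₀ ℕ.+ m)) ≡⟨ solve 3 (λ l a i → l :* (a :* i) := a :* (i :* l)) refl (ℕ→ℚ L) (1ℚ - β) (1/suc (n₀ ℕ.+ m)) ⟩
    (1ℚ - β) * (1/suc (n₀ ℕ.+ m) * ℕ→ℚ L) ≡⟨ cong ((1ℚ - β) *_) ([1/1+k]*[1+k]≡1 (n₀ ℕ.+ m)) ⟩
    (1ℚ - β) * 1ℚ                          ≡⟨ *-identityʳ _ ⟩
    1ℚ - β                                 ∎
    where open ≡-Reasoning

  nu : ℚ
  nu = nq * u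

  0<nu : 0ℚ < nu
  0<nu = *-pos (0<ℕ→ℚ-suc n₀) 0<u

  1-β-nu≡mu : (1ℚ - β) - nu ≡ mq * u
  1-β-nu≡mu = begin
    (1ℚ - β) - nq * u        ≡⟨ cong (_- nq * u) (sym L*u≡1-β) ⟩
    ℕ→ℚ L * u - nq * u       ≡⟨ cong (λ x → x * u - nq * u) (ℕ→ℚ-homo-+ n m) ⟩
    (nq + mq) * u - nq * u   ≡⟨ solve 3 (λ a b c → (a :+ b) :* c :- a :* c := b :* c) refl nq mq u ⟩
    mq * u                   ∎
    where open ≡-Reasoning

  nu≤1-β : nu ≤ 1ℚ - β
  nu≤1-β = 0≤q-p⇒p≤q (subst (0ℚ ≤_) (sym 1-β-nu≡mu) (*-nonNeg (0≤ℕ→ℚ m) 0≤u))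

  1-δ₀<α : ∀ {α} → 1ℚ - α ≤ 1ℚ - β → 1ℚ - δ₀ < α
  1-δ₀<α {α} 1-α≤1-β = 0<q-p⇒p<q (subst (0ℚ <_) (solve 3 (λ a o d → d :- (o :- a) := a :- (o :- d)) refl α 1ℚ δ₀)
    (p<q⇒0<q-p (≤-<-trans 1-α≤1-β 1-β<δ₀)))
    where
    1-β<δ₀ : 1ℚ - β < δ₀
    1-β<δ₀ = 0<q-p⇒p<q (subst (0ℚ <_) (solve 3 (λ b o d → b :- (o :- d) := d :- (o :- b)) refl β 1ℚ δ₀) (p<q⇒0<q-p 1-δ₀<β))

  -- Laziness of the image of m_β under the projection onto the factor.
  αᵖ : ℚ
  αᵖ = β + mq * u

  1-αᵖ≡nu : 1ℚ - αᵖ ≡ nu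
  1-αᵖ≡nu = begin
    1ℚ - (β + mq * u)   ≡⟨ cong (λ x → 1ℚ - (β + x)) (sym 1-β-nu≡mu) ⟩
    1ℚ - (β + ((1ℚ - β) - nu)) ≡⟨ solve 2 (λ b v → con 1ℚ :- (b :+ ((con 1ℚ :- b) :- v)) := v) refl β nu ⟩
    nu ∎
    where open ≡-Reasoning

  mass-αᵖ : ∀ l → mass αᵖ n (suc l) ≡ u
  mass-αᵖ l = begin
    (1ℚ - αᵖ) * 1/suc n₀    ≡⟨ cong (_* 1/suc n₀) 1-αᵖ≡nu ⟩
    nq * u * 1/suc n₀       ≡⟨ solve 3 (λ a b c → a :* b :* c := b :* (c :* a)) refl nq u (1/suc n₀) ⟩
    u * (1/suc n₀ * nq)     ≡⟨ cong (u *_) ([1/1+k]*[1+k]≡1 n₀) ⟩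
    u * 1ℚ                  ≡⟨ *-identityʳ u ⟩
    u                       ∎
    where open ≡-Reasoning

  0≤αᵖ : 0ℚ ≤ αᵖ
  0≤αᵖ = +-nonNeg 0≤β (*-nonNeg (0≤ℕ→ℚ m) 0≤u)

  αᵖ<1 : αᵖ < 1ℚ
  αᵖ<1 = 0<q-p⇒p<q (subst (0ℚ <_) (sym 1-αᵖ≡nu) 0<nu)

  1-δ₀<αᵖ : 1ℚ - δ₀ < αᵖ
  1-δ₀<αᵖ = 1-δ₀<α (subst (_≤ 1ℚ - β) (sym 1-αᵖ≡nu) nu≤1-β)

  -- Total mass of m_β on the fibre through the edge, and the laziness of its normalisation.
  c : ℚ
  c = β + nu

  0<c : 0ℚ < c
  0<c = subst (0ℚ <_) (+-comm nu β) (+-pos 0<nu 0≤β)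

  c*recip-c≡1 : c * recip c ≡ 1ℚ
  c*recip-c≡1 = *-recipʳ c (0<p⇒p≢0 0<c)

  αˢ : ℚ
  αˢ = β * recip c

  c*αˢ≡β : c * αˢ ≡ β
  c*αˢ≡β = trans (solve 3 (λ c b i → c :* (b :* i) := b :* (c :* i)) refl c β (recip c))
    (trans (cong (β *_) c*recip-c≡1) (*-identityʳ β))

  1-αˢ≡ : 1ℚ - αˢ ≡ nu * recip c
  1-αˢ≡ = begin
    1ℚ - β * recip c                   ≡⟨ cong (_- β * recip c) (sym c*recip-c≡1) ⟩
    c * recip c - β * recip c          ≡⟨ solve 3 (λ b v i → (b :+ v) :* i :- b :* i := v :* i) refl β nu (recip c) ⟩
    nu * recip c                       ∎
    where open ≡-Reasoning

  c*mass-αˢ : ∀ l → c * mass αˢ n (suc l) ≡ u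
  c*mass-αˢ l = begin
    c * ((1ℚ - αˢ) * 1/suc n₀)         ≡⟨ cong (λ x → c * (x * 1/suc n₀)) 1-αˢ≡ ⟩
    c * (nq * u * recip c * 1/suc n₀)
      ≡⟨ solve 5 (λ c a b i j → c :* (a :* b :* i :* j) := b :* ((c :* i) :* (j :* a))) refl c nq u (recip c) (1/suc n₀) ⟩
    u * ((c * recip c) * (1/suc n₀ * nq)) ≡⟨ cong₂ (λ x y → u * (x * y)) c*recip-c≡1 ([1/1+k]*[1+k]≡1 n₀) ⟩
    u * (1ℚ * 1ℚ)                      ≡⟨ *-identityʳ u ⟩
    u                                  ∎
    where open ≡-Reasoning

  0<recip-c : 0ℚ < recip c
  0<recip-c = recip-pos c 0<c

  0≤αˢ : 0ℚ ≤ αˢ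
  0≤αˢ = *-nonNeg 0≤β (<⇒≤ 0<recip-c)

  αˢ<1 : αˢ < 1ℚ
  αˢ<1 = 0<q-p⇒p<q (subst (0ℚ <_) (sym 1-αˢ≡) (*-pos 0<nu 0<recip-c))

  1-αˢ≤1-β : 1ℚ - αˢ ≤ 1ℚ - β
  1-αˢ≤1-β = subst₂ _≤_ (sym 1-αˢ≡) (trans (*-assoc (1ℚ - β) c (recip c)) (trans (cong ((1ℚ - β) *_) c*recip-c≡1) (*-identityʳ _)))
    (*-monoʳ-≤-nonNeg (recip c) {{nonNegative (<⇒≤ 0<recip-c)}} nu≤[1-β]c)
    where
    nu≤[1-β]c : nu ≤ (1ℚ - β) * c
    nu≤[1-β]c = 0≤q-p⇒p≤q (subst (0ℚ ≤_) (solve 2 (λ b v → b :* ((con 1ℚ :- b) :- v) := (con 1ℚ :- b) :* (b :+ v) :- v) refl β nu)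
      (*-nonNeg 0≤β (p≤q⇒0≤q-p nu≤1-β)))

  1-δ₀<αˢ : 1ℚ - δ₀ < αˢ
  1-δ₀<αˢ = 1-δ₀<α 1-αˢ≤1-β

  abstract
    factorInf : ∀ α → 0ℚ ≤ α → α ≤ 1ℚ → Σ ℚ (IsInfCost (suc n) (suc n) (mass α n) (mass α n) Dᶠ)
    factorInf α 0≤α α≤1 = lazyInfCost-exists n₀ α 0≤α α≤1 Dᶠ

  factorW : ∀ α → 0ℚ ≤ α → 1ℚ - δ₀ < α → α < 1ℚ →
    Σ ℚ (λ w′ → IsInfCost (suc n) (suc n) (mass α n) (mass α n) Dᶠ w′ × ∣ 1ℚ - w′ ∣ < ε * (1ℚ - α))
  factorW α 0≤α 1-δ₀<α α<1 = w′ , w′-inf ,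
    subst₂ (λ d r → ∣ d - w′ ∣ < r) (cong ℕ→ℚ Dᶠ-edge) (trans (cong (ε * (1ℚ - α) *_) (cong ℕ→ℚ Dᶠ-edge)) (*-identityʳ _))
      (factor-flat α 0≤α 1-δ₀<α α<1 w′ w′-inf)
    where
    w′ = proj₁ (factorInf α 0≤α (<⇒≤ α<1))
    w′-inf = proj₂ (factorInf α 0≤α (<⇒≤ α<1))

  mass⊎ : Fin (suc n) ⊎ Fin m → ℚ
  mass⊎ (inj₁ zero)    = β
  mass⊎ (inj₁ (suc _)) = u
  mass⊎ (inj₂ _)       = u

  mass-split : ∀ (S : SupportSplit L n m) s → mass β L s ≡ mass⊎ (SupportSplit.split S s)
  mass-split S zero    = sym (cong mass⊎ (SupportSplit.split-centre S))
  mass-split S (suc s) = by-cases (SupportSplit.split S (suc s)) refl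
    where
    by-cases : ∀ x → SupportSplit.split S (suc s) ≡ x → u ≡ mass⊎ x
    by-cases (inj₁ zero)    e = ⊥-elim (SupportSplit.split-suc≢centre S s e)
    by-cases (inj₁ (suc _)) e = refl
    by-cases (inj₂ _)       e = refl

  module Projection (A : Fin (suc L) → Fin (suc L) → ℚ) (A-coupling : IsCoupling (suc L) (suc L) (mass β L) (mass β L) A) where

    open Pushforward (λ s → toFactor (X.split s)) (λ t → toFactor (Y.split t)) A public

    sum-δ-toFactor : ∀ i → sumFin (suc n) (λ i′ → δ (toFactor {n} {m} (inj₁ i′)) i * mass⊎ (inj₁ i′))
                           + sumFin m (λ k → δ (toFactor {n} {m} (inj₂ k)) i * mass⊎ (inj₂ k)) ≡ mass αᵖ n i
    sum-δ-toFactor i = trans (cong₂ _+_ (sum-δʳ (suc n) i (λ i′ → mass⊎ (inj₁ i′))) (sum-const m (δ zero i * u))) (at i)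
      where
      at : ∀ i → mass⊎ (inj₁ i) + mq * (δ zero i * u) ≡ mass αᵖ n i
      at zero    = cong (λ x → β + mq * x) (trans (cong (_* u) (δ-refl zero)) (*-identityˡ u))
      at (suc l) = trans (cong (λ x → u + mq * x) (trans (cong (_* u) (δ-0-suc l)) (*-zeroˡ u)))
                     (trans (cong (λ x → u + x) (*-zeroʳ mq)) (trans (+-identityʳ u) (sym (mass-αᵖ l))))

    projected : IsCoupling (suc n) (suc n) (mass αᵖ n) (mass αᵖ n) B
    projected = 0≤B (proj₁ A-coupling) ,
      (λ i → begin
        sumFin (suc n) (B i) ≡⟨ B-row-sum i ⟩
        sumFin (suc L) (λ s → δ (toFactor (X.split s)) i * sumFin (suc L) (A s))
          ≡⟨ sum-cong (suc L) (λ s → cong (δ (toFactor (X.split s)) i *_) (trans (proj₁ (proj₂ A-coupling) s) (mass-split X s))) ⟩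
        sumFin (suc L) (λ s → δ (toFactor (X.split s)) i * mass⊎ (X.split s)) ≡⟨ X.sum-split (λ x → δ (toFactor x) i * mass⊎ x) ⟩
        _ ≡⟨ sum-δ-toFactor i ⟩
        mass αᵖ n i ∎) ,
      (λ j → begin
        sumFin (suc n) (λ i → B i j) ≡⟨ B-col-sum j ⟩
        sumFin (suc L) (λ t → δ (toFactor (Y.split t)) j * sumFin (suc L) (λ s → A s t))
          ≡⟨ sum-cong (suc L) (λ t → cong (δ (toFactor (Y.split t)) j *_) (trans (proj₂ (proj₂ A-coupling) t) (mass-split Y t))) ⟩
        sumFin (suc L) (λ t → δ (toFactor (Y.split t)) j * mass⊎ (Y.split t)) ≡⟨ Y.sum-split (λ x → δ (toFactor x) j * mass⊎ x) ⟩
        _ ≡⟨ sum-δ-toFactor j ⟩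
        mass αᵖ n j ∎)
      where open ≡-Reasoning

    projected-cost≤ : cost (suc n) (suc n) Dᶠ B ≤ cost (suc L) (suc L) D A
    projected-cost≤ = subst (_≤ cost (suc L) (suc L) D A) (sym (B-cost (λ i j → ℕ→ℚ (Dᶠ i j))))
      (sum-mono-≤ (suc L) (λ s → sum-mono-≤ (suc L) (λ t → *-monoˡ-≤-0≤ (proj₁ A-coupling s t) (ℕ→ℚ-mono-≤ (projection≤ s t)))))

  1-w<ε[1-β] : 1ℚ - w < ε * (1ℚ - β)
  1-w<ε[1-β] = begin-strict
    1ℚ - w            ≤⟨ +-monoʳ-≤ 1ℚ (neg-antimono-≤ wᵖ≤w) ⟩
    1ℚ - wᵖ           ≤⟨ p≤∣p∣ (1ℚ - wᵖ) ⟩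
    ∣ 1ℚ - wᵖ ∣       <⟨ proj₂ (proj₂ Wᵖ) ⟩
    ε * (1ℚ - αᵖ)     ≡⟨ cong (ε *_) 1-αᵖ≡nu ⟩
    ε * nu            ≤⟨ *-monoˡ-≤-0≤ (<⇒≤ 0<ε) nu≤1-β ⟩
    ε * (1ℚ - β)      ∎
    where
    open ≤-Reasoning
    Wᵖ = factorW αᵖ 0≤αᵖ 1-δ₀<αᵖ αᵖ<1
    wᵖ = proj₁ Wᵖ
    wᵖ≤w : wᵖ ≤ w
    wᵖ≤w = infCost-mono (mass β L) (mass β L) D (mass αᵖ n) (mass αᵖ n) Dᶠ (proj₁ (proj₂ Wᵖ)) w-inf (λ A A-coupling →
      Projection.B A A-coupling , Projection.projected A A-coupling , Projection.projected-cost≤ A A-coupling)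

  -- Couple the fibre part by c·C for an almost optimal factor coupling C, and each neighbour along
  -- the other factor with its translate across the edge, at distance at most 1.
  module Lifting where

    Wˢ = factorW αˢ 0≤αˢ 1-δ₀<αˢ αˢ<1
    wˢ = proj₁ Wˢ

    wˢ<1+ε[1-αˢ] : wˢ < 1ℚ + ε * (1ℚ - αˢ)
    wˢ<1+ε[1-αˢ] = 0<q-p⇒p<q (subst (0ℚ <_)
      (solve 3 (λ w e a → e :* (con 1ℚ :- a) :- (:- (con 1ℚ :- w)) := (con 1ℚ :+ e :* (con 1ℚ :- a)) :- w) refl wˢ ε αˢ)
      (p<q⇒0<q-p (≤-<-trans (-p≤∣p∣ (1ℚ - wˢ)) (proj₂ (proj₂ Wˢ)))))

    almostOptimal = coupling-below (mass αˢ n) (mass αˢ n) Dᶠ (proj₁ (proj₂ Wˢ)) wˢ<1+ε[1-αˢ]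
    C = proj₁ almostOptimal
    C-coupling = proj₁ (proj₂ almostOptimal)
    cost-C< = proj₂ (proj₂ almostOptimal)

    lift : Fin (suc n) ⊎ Fin m → Fin (suc n) ⊎ Fin m → ℚ
    lift (inj₁ i) (inj₁ j)  = c * C i j
    lift (inj₂ k) (inj₂ k′) = δ k k′ * u
    lift (inj₁ _) (inj₂ _)  = 0ℚ
    lift (inj₂ _) (inj₁ _)  = 0ℚ

    0≤lift : ∀ x y → 0ℚ ≤ lift x y
    0≤lift (inj₁ i) (inj₁ j)  = *-nonNeg (<⇒≤ 0<c) (proj₁ C-coupling i j)
    0≤lift (inj₂ k) (inj₂ k′) = *-nonNeg (0≤δ k k′) 0≤u
    0≤lift (inj₁ _) (inj₂ _)  = ≤-refl
    0≤lift (inj₂ _) (inj₁ _)  = ≤-refl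

    c*mass-αˢ≡mass⊎ : ∀ i → c * mass αˢ n i ≡ mass⊎ (inj₁ i)
    c*mass-αˢ≡mass⊎ zero    = c*αˢ≡β
    c*mass-αˢ≡mass⊎ (suc l) = c*mass-αˢ l

    lift-row-sum : ∀ x → sumFin (suc n) (λ j → lift x (inj₁ j)) + sumFin m (λ k → lift x (inj₂ k)) ≡ mass⊎ x
    lift-row-sum (inj₁ i) = trans (cong₂ _+_ (trans (sum-*ˡ (suc n) c (C i)) (cong (c *_) (proj₁ (proj₂ C-coupling) i))) (sum-zero m))
                              (trans (+-identityʳ _) (c*mass-αˢ≡mass⊎ i))
    lift-row-sum (inj₂ k) = trans (cong₂ _+_ (sum-zero (suc n)) (sum-δˡ m k (λ _ → u))) (+-identityˡ u)

    lift-col-sum : ∀ y → sumFin (suc n) (λ i → lift (inj₁ i) y) + sumFin m (λ k → lift (inj₂ k) y) ≡ mass⊎ y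
    lift-col-sum (inj₁ j) = trans (cong₂ _+_ (trans (sum-*ˡ (suc n) c (λ i → C i j)) (cong (c *_) (proj₂ (proj₂ C-coupling) j))) (sum-zero m))
                              (trans (+-identityʳ _) (c*mass-αˢ≡mass⊎ j))
    lift-col-sum (inj₂ k′) = trans (cong₂ _+_ (sum-zero (suc n)) (sum-δʳ m k′ (λ _ → u))) (+-identityˡ u)

    lifted : Fin (suc L) → Fin (suc L) → ℚ
    lifted s t = lift (X.split s) (Y.split t)

    lifted-coupling : IsCoupling (suc L) (suc L) (mass β L) (mass β L) lifted
    lifted-coupling = (λ s t → 0≤lift (X.split s) (Y.split t)) ,
      (λ s → trans (Y.sum-split (lift (X.split s))) (trans (lift-row-sum (X.split s)) (sym (mass-split X s)))) ,
      (λ t → trans (X.sum-split (λ x → lift x (Y.split t))) (trans (lift-col-sum (Y.split t)) (sym (mass-split Y t))))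

    D⊎ : Fin (suc n) ⊎ Fin m → Fin (suc n) ⊎ Fin m → ℚ
    D⊎ x y = ℕ→ℚ (D (X.unsplit x) (Y.unsplit y))

    row-cost : Fin (suc n) ⊎ Fin m → ℚ
    row-cost x = sumFin (suc n) (λ j → lift x (inj₁ j) * D⊎ x (inj₁ j)) + sumFin m (λ k → lift x (inj₂ k) * D⊎ x (inj₂ k))

    row-cost-fibre : ∀ i → row-cost (inj₁ i) ≡ c * sumFin (suc n) (λ j → C i j * ℕ→ℚ (Dᶠ i j))
    row-cost-fibre i = trans (cong₂ _+_
        (trans (sum-cong (suc n) (λ j → *-assoc c (C i j) (ℕ→ℚ (Dᶠ i j)))) (sum-*ˡ (suc n) c (λ j → C i j * ℕ→ℚ (Dᶠ i j))))
        (sum-zeros m _ (λ k → *-zeroˡ (D⊎ (inj₁ i) (inj₂ k)))))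
      (+-identityʳ _)

    row-cost-parallel : ∀ k → row-cost (inj₂ k) ≡ u * D⊎ (inj₂ k) (inj₂ k)
    row-cost-parallel k = trans (cong₂ _+_
        (sum-zeros (suc n) _ (λ j → *-zeroˡ (D⊎ (inj₂ k) (inj₁ j))))
        (trans (sum-cong m (λ k′ → *-assoc (δ k k′) u (D⊎ (inj₂ k) (inj₂ k′)))) (sum-δˡ m k (λ k′ → u * D⊎ (inj₂ k) (inj₂ k′)))))
      (+-identityˡ _)

    cost-lifted : cost (suc L) (suc L) D lifted ≡ c * cost (suc n) (suc n) Dᶠ C + sumFin m (λ k → u * D⊎ (inj₂ k) (inj₂ k))
    cost-lifted = begin
      cost (suc L) (suc L) D lifted
        ≡⟨ sum-cong (suc L) (λ s → sum-cong (suc L) (λ t → cong (λ z → lifted s t * ℕ→ℚ z) (sym (cong₂ D (X.unsplit-split s) (Y.unsplit-split t))))) ⟩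
      sumFin (suc L) (λ s → sumFin (suc L) (λ t → lift (X.split s) (Y.split t) * D⊎ (X.split s) (Y.split t)))
        ≡⟨ sum-cong (suc L) (λ s → Y.sum-split (λ y → lift (X.split s) y * D⊎ (X.split s) y)) ⟩
      sumFin (suc L) (λ s → row-cost (X.split s))
        ≡⟨ X.sum-split row-cost ⟩
      sumFin (suc n) (λ i → row-cost (inj₁ i)) + sumFin m (λ k → row-cost (inj₂ k))
        ≡⟨ cong₂ _+_ (trans (sum-cong (suc n) row-cost-fibre) (sum-*ˡ (suc n) c (λ i → sumFin (suc n) (λ j → C i j * ℕ→ℚ (Dᶠ i j))))) (sum-cong m row-cost-parallel) ⟩
      c * cost (suc n) (suc n) Dᶠ C + sumFin m (λ k → u * D⊎ (inj₂ k) (inj₂ k)) ∎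
      where open ≡-Reasoning

    parallel-cost≤ : sumFin m (λ k → u * D⊎ (inj₂ k) (inj₂ k)) ≤ mq * u
    parallel-cost≤ = subst (sumFin m (λ k → u * D⊎ (inj₂ k) (inj₂ k)) ≤_) (trans (sum-const m (u * 1ℚ)) (cong (mq *_) (*-identityʳ u)))
      (sum-mono-≤ m (λ k → *-monoˡ-≤-0≤ 0≤u (ℕ→ℚ-mono-≤ (parallel≤1 k))))

    bound≡ : c * (1ℚ + ε * (1ℚ - αˢ)) + mq * u ≡ 1ℚ + ε * nu
    bound≡ = begin
      c * (1ℚ + ε * (1ℚ - αˢ)) + mq * u
        ≡⟨ solve 4 (λ c e a x → c :* (con 1ℚ :+ e :* (con 1ℚ :- a)) :+ x := (c :+ x) :+ e :* (c :* (con 1ℚ :- a))) refl c ε αˢ (mq * u) ⟩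
      (c + mq * u) + ε * (c * (1ℚ - αˢ)) ≡⟨ cong₂ (λ x y → x + ε * y) c+mu≡1 c[1-αˢ]≡nu ⟩
      1ℚ + ε * nu ∎
      where
      open ≡-Reasoning
      c+mu≡1 : c + mq * u ≡ 1ℚ
      c+mu≡1 = trans (cong (λ x → β + nu + x) (sym 1-β-nu≡mu)) (solve 2 (λ b v → b :+ v :+ ((con 1ℚ :- b) :- v) := con 1ℚ) refl β nu)
      c[1-αˢ]≡nu : c * (1ℚ - αˢ) ≡ nu
      c[1-αˢ]≡nu = trans (cong (c *_) 1-αˢ≡)
        (trans (solve 3 (λ c v i → c :* (v :* i) := v :* (c :* i)) refl c nu (recip c)) (trans (cong (nu *_) c*recip-c≡1) (*-identityʳ nu)))

  w-1<ε[1-β] : - (1ℚ - w) < ε * (1ℚ - β)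
  w-1<ε[1-β] = begin-strict
    - (1ℚ - w)                                  ≡⟨ solve 1 (λ w → :- (con 1ℚ :- w) := w :- con 1ℚ) refl w ⟩
    w - 1ℚ                                      ≤⟨ +-monoˡ-≤ (- 1ℚ) (proj₁ w-inf lifted lifted-coupling) ⟩
    cost (suc L) (suc L) D lifted - 1ℚ          ≡⟨ cong (_- 1ℚ) cost-lifted ⟩
    c * cost (suc n) (suc n) Dᶠ C + parallel - 1ℚ ≤⟨ +-monoˡ-≤ (- 1ℚ) (+-monoʳ-≤ (c * cost (suc n) (suc n) Dᶠ C) parallel-cost≤) ⟩
    c * cost (suc n) (suc n) Dᶠ C + mq * u - 1ℚ <⟨ +-monoˡ-< (- 1ℚ) (+-monoˡ-< (mq * u) (*-monoʳ-<-0< 0<c cost-C<)) ⟩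
    c * (1ℚ + ε * (1ℚ - αˢ)) + mq * u - 1ℚ      ≡⟨ cong (_- 1ℚ) bound≡ ⟩
    1ℚ + ε * nu - 1ℚ                            ≡⟨ solve 2 (λ e v → con 1ℚ :+ e :* v :- con 1ℚ := e :* v) refl ε nu ⟩
    ε * nu                                      ≤⟨ *-monoˡ-≤-0≤ (<⇒≤ 0<ε) nu≤1-β ⟩
    ε * (1ℚ - β)                                ∎
    where
    open ≤-Reasoning
    open Lifting
    parallel = sumFin m (λ k → u * D⊎ (inj₂ k) (inj₂ k))

  ∣1-w∣<ε[1-β] : ∣ 1ℚ - w ∣ < ε * (1ℚ - β)
  ∣1-w∣<ε[1-β] = p<q∧-p<q⇒∣p∣<q 1-w<ε[1-β] w-1<ε[1-β]

CurvatureZeroFor : (nx ny : ℕ) → ((Fin (suc nx) → Fin (suc ny) → ℕ) → Set) → Set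
CurvatureZeroFor nx ny IsDist =
  ∀ D → IsDist D → ∀ ε → Positive ε → Σ ℚ (λ δ → Positive δ ×
    (∀ α → 0ℚ ≤ α → 1ℚ - δ < α → α < 1ℚ →
     ∀ w → Transport.IsInfCost (suc nx) (suc ny) (mass α nx) (mass α ny) D w →
     ∣ ℕ→ℚ (D zero zero) - w ∣ < ε * (1ℚ - α) * ℕ→ℚ (D zero zero)))

curvatureZero-product : ∀ n₀ m {LX LY nx ny} → LX ≡ suc (n₀ ℕ.+ m) → LY ≡ suc (n₀ ℕ.+ m) → nx ≡ suc n₀ → ny ≡ suc n₀ →
  (X : SupportSplit LX nx m) (Y : SupportSplit LY ny m) →
  (IsDistᶠ : (Fin (suc nx) → Fin (suc ny) → ℕ) → Set) → CurvatureZeroFor nx ny IsDistᶠ →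
  (IsDist : (Fin (suc LX) → Fin (suc LY) → ℕ) → Set) →
  (∀ D → IsDist D → IsDistᶠ (λ i j → D (SupportSplit.unsplit X (inj₁ i)) (SupportSplit.unsplit Y (inj₁ j)))) →
  (∀ D → IsDist D → EdgeDistances X Y D) →
  CurvatureZeroFor LX LY IsDist
curvatureZero-product n₀ m refl refl refl refl X Y IsDistᶠ factor-flat IsDist restrict edge D D-dist ε ε>0 =
  δ₀ , δ₀>0 , bound
  where
  flat = factor-flat _ (restrict D D-dist) ε ε>0
  δ₀ = proj₁ flat
  δ₀>0 = proj₁ (proj₂ flat)
  bound : ∀ β → 0ℚ ≤ β → 1ℚ - δ₀ < β → β < 1ℚ → ∀ w →
    Transport.IsInfCost (suc (suc (n₀ ℕ.+ m))) (suc (suc (n₀ ℕ.+ m))) (mass β (suc (n₀ ℕ.+ m))) (mass β (suc (n₀ ℕ.+ m))) D w →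
    ∣ ℕ→ℚ (D zero zero) - w ∣ < ε * (1ℚ - β) * ℕ→ℚ (D zero zero)
  bound β 0≤β 1-δ₀<β β<1 w w-inf =
    subst (λ d → ∣ d - w ∣ < ε * (1ℚ - β) * d) (cong ℕ→ℚ (sym (EdgeDistances.edge≡1 (edge D D-dist))))
      (subst (∣ 1ℚ - w ∣ <_) (sym (*-identityʳ _))
        (ProductEdge.∣1-w∣<ε[1-β] n₀ m X Y D (edge D D-dist) ε (positive⁻¹ ε {{ε>0}}) δ₀ (proj₂ (proj₂ flat)) β 0≤β 1-δ₀<β β<1 w w-inf))

module ListIndex {A : Set} where

  ++-join : (xs ys : List A) → Fin (length xs) ⊎ Fin (length ys) → Fin (length (xs ++ ys))
  ++-join []       ys (inj₂ j)       = j
  ++-join (x ∷ xs) ys (inj₁ zero)    = zero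
  ++-join (x ∷ xs) ys (inj₁ (suc i)) = suc (++-join xs ys (inj₁ i))
  ++-join (x ∷ xs) ys (inj₂ j)       = suc (++-join xs ys (inj₂ j))

  ++-split : (xs ys : List A) → Fin (length (xs ++ ys)) → Fin (length xs) ⊎ Fin (length ys)
  ++-split []       ys r       = inj₂ r
  ++-split (x ∷ xs) ys zero    = inj₁ zero
  ++-split (x ∷ xs) ys (suc r) = Sum.map₁ suc (++-split xs ys r)

  ++-join-split : ∀ xs ys r → ++-join xs ys (++-split xs ys r) ≡ r
  ++-join-split []       ys r    = refl
  ++-join-split (x ∷ xs) ys zero = refl
  ++-join-split (x ∷ xs) ys (suc r) with ++-split xs ys r | ++-join-split xs ys r
  ... | inj₁ i | e = cong suc e
  ... | inj₂ j | e = cong suc e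

  ++-split-join : ∀ xs ys u → ++-split xs ys (++-join xs ys u) ≡ u
  ++-split-join []       ys (inj₂ j)       = refl
  ++-split-join (x ∷ xs) ys (inj₁ zero)    = refl
  ++-split-join (x ∷ xs) ys (inj₁ (suc i)) rewrite ++-split-join xs ys (inj₁ i) = refl
  ++-split-join (x ∷ xs) ys (inj₂ j)       rewrite ++-split-join xs ys (inj₂ j) = refl

  lookup-++-join₁ : ∀ xs ys i → lookup (xs ++ ys) (++-join xs ys (inj₁ i)) ≡ lookup xs i
  lookup-++-join₁ (x ∷ xs) ys zero    = refl
  lookup-++-join₁ (x ∷ xs) ys (suc i) = lookup-++-join₁ xs ys i

  lookup-++-join₂ : ∀ xs ys j → lookup (xs ++ ys) (++-join xs ys (inj₂ j)) ≡ lookup ys j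
  lookup-++-join₂ []       ys j = refl
  lookup-++-join₂ (x ∷ xs) ys j = lookup-++-join₂ xs ys j

  module _ {B : Set} (f : B → A) where

    fromMap : (xs : List B) → Fin (length (map f xs)) → Fin (length xs)
    fromMap (x ∷ xs) zero    = zero
    fromMap (x ∷ xs) (suc i) = suc (fromMap xs i)

    toMap : (xs : List B) → Fin (length xs) → Fin (length (map f xs))
    toMap (x ∷ xs) zero    = zero
    toMap (x ∷ xs) (suc i) = suc (toMap xs i)

    fromMap-toMap : ∀ xs i → fromMap xs (toMap xs i) ≡ i
    fromMap-toMap (x ∷ xs) zero    = refl
    fromMap-toMap (x ∷ xs) (suc i) = cong suc (fromMap-toMap xs i)

    toMap-fromMap : ∀ xs i → toMap xs (fromMap xs i) ≡ i
    toMap-fromMap (x ∷ xs) zero    = refl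
    toMap-fromMap (x ∷ xs) (suc i) = cong suc (toMap-fromMap xs i)

    lookup-toMap : ∀ xs i → lookup (map f xs) (toMap xs i) ≡ f (lookup xs i)
    lookup-toMap (x ∷ xs) zero    = refl
    lookup-toMap (x ∷ xs) (suc i) = lookup-toMap xs i

record Indexing (L n m : ℕ) : Set where
  field
    to      : Fin L → Fin n ⊎ Fin m
    from    : Fin n ⊎ Fin m → Fin L
    from-to : ∀ r → from (to r) ≡ r
    to-from : ∀ x → to (from x) ≡ x

  swapped : Indexing L m n
  swapped = record
    { to = λ r → Sum.swap (to r) ; from = λ x → from (Sum.swap x)
    ; from-to = λ r → trans (cong from (swap-involutive (to r))) (from-to r)
    ; to-from = λ x → trans (cong Sum.swap (to-from (Sum.swap x))) (swap-involutive x) }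

  withCentre : SupportSplit L n m
  withCentre = record
    { split = split ; unsplit = unsplit ; unsplit-split = unsplit-split ; split-unsplit = split-unsplit
    ; unsplit-centre = refl }
    where
    split : Fin (suc L) → Fin (suc n) ⊎ Fin m
    split zero    = inj₁ zero
    split (suc r) = Sum.map₁ suc (to r)
    unsplit : Fin (suc n) ⊎ Fin m → Fin (suc L)
    unsplit (inj₁ zero)    = zero
    unsplit (inj₁ (suc i)) = suc (from (inj₁ i))
    unsplit (inj₂ k)       = suc (from (inj₂ k))
    unsplit-split : ∀ s → unsplit (split s) ≡ s
    unsplit-split zero = refl
    unsplit-split (suc r) with to r | from-to r
    ... | inj₁ i | e = cong suc e
    ... | inj₂ k | e = cong suc e
    split-unsplit : ∀ x → split (unsplit x) ≡ x
    split-unsplit (inj₁ zero)    = refl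
    split-unsplit (inj₁ (suc i)) = cong (Sum.map₁ suc) (to-from (inj₁ i))
    split-unsplit (inj₂ k)       = cong (Sum.map₁ suc) (to-from (inj₂ k))

module ConcatMaps {V B₁ B₂ : Set} (f : B₁ → V) (g : B₂ → V) (xs : List B₁) (ys : List B₂) where
  open ListIndex

  indexing : Indexing (length (map f xs ++ map g ys)) (length xs) (length ys)
  indexing = record
    { to = λ r → Sum.map (fromMap f xs) (fromMap g ys) (++-split (map f xs) (map g ys) r)
    ; from = λ x → ++-join (map f xs) (map g ys) (Sum.map (toMap f xs) (toMap g ys) x)
    ; from-to = from-to ; to-from = to-from }
    where
    from-to : ∀ r → ++-join (map f xs) (map g ys) (Sum.map (toMap f xs) (toMap g ys)
                       (Sum.map (fromMap f xs) (fromMap g ys) (++-split (map f xs) (map g ys) r))) ≡ r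
    from-to r with ++-split (map f xs) (map g ys) r | ++-join-split (map f xs) (map g ys) r
    ... | inj₁ i | e = trans (cong (λ z → ++-join (map f xs) (map g ys) (inj₁ z)) (toMap-fromMap f xs i)) e
    ... | inj₂ j | e = trans (cong (λ z → ++-join (map f xs) (map g ys) (inj₂ z)) (toMap-fromMap g ys j)) e
    to-from : ∀ x → Sum.map (fromMap f xs) (fromMap g ys) (++-split (map f xs) (map g ys)
                       (++-join (map f xs) (map g ys) (Sum.map (toMap f xs) (toMap g ys) x))) ≡ x
    to-from (inj₁ i) rewrite ++-split-join (map f xs) (map g ys) (inj₁ (toMap f xs i)) = cong inj₁ (fromMap-toMap f xs i)
    to-from (inj₂ j) rewrite ++-split-join (map f xs) (map g ys) (inj₂ (toMap g ys j)) = cong inj₂ (fromMap-toMap g ys j)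

  open Indexing indexing

  lookup-from₁ : ∀ i → lookup (map f xs ++ map g ys) (from (inj₁ i)) ≡ f (lookup xs i)
  lookup-from₁ i = trans (lookup-++-join₁ (map f xs) (map g ys) (toMap f xs i)) (lookup-toMap f xs i)

  lookup-from₂ : ∀ j → lookup (map f xs ++ map g ys) (from (inj₂ j)) ≡ g (lookup ys j)
  lookup-from₂ j = trans (lookup-++-join₂ (map f xs) (map g ys) (toMap g ys j)) (lookup-toMap g ys j)

module _ {G : PreGraph} where

  walk-length-0 : ∀ {p q} → Walk G p q 0 → p ≡ q
  walk-length-0 here = refl

  Dist-adj≤1 : ∀ {p q k} → Dist G p q k → Adj G p q → k ℕ.≤ 1
  Dist-adj≤1 (_ , shortest) adj = shortest 1 (step adj here)

  Dist-adj≡1 : ∀ {p q k} → Dist G p q k → Adj G p q → ¬ p ≡ q → k ≡ 1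
  Dist-adj≡1 {k = zero}        (w , _) adj p≢q = ⊥-elim (p≢q (walk-length-0 w))
  Dist-adj≡1 {k = suc zero}    d adj p≢q = refl
  Dist-adj≡1 {k = suc (suc k)} d adj p≢q with Dist-adj≤1 d adj
  ... | ℕ.s≤s ()

length≡suc-pred : ∀ {A : Set} {y : A} {xs : List A} → y ∈ xs → length xs ≡ suc (ℕ.pred (length xs))
length≡suc-pred (here _)  = refl
length≡suc-pred (there _) = refl

module ProductWalks (G H : PreGraph) where
  private
    module G = PreGraph G
    module H = PreGraph H

  walk-proj₁ : ∀ {p q k} → Walk (G □ H) p q k → Σ ℕ (λ k′ → k′ ℕ.≤ k × Walk G (proj₁ p) (proj₁ q) k′)
  walk-proj₁ here = 0 , ℕ.z≤n , here
  walk-proj₁ {p = u , v} {q} (step adj w) with ∈-++⁻ (map (λ v′ → (u , v′)) (H.nbrs v)) adj | walk-proj₁ w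
  ... | inj₁ along-H | k′ , le , wG with ∈-map⁻ (λ v′ → (u , v′)) along-H
  ...   | _ , _ , refl = k′ , ℕP.m≤n⇒m≤1+n le , wG
  walk-proj₁ {p = u , v} {q} (step adj w) | inj₂ along-G | k′ , le , wG with ∈-map⁻ (λ u′ → (u′ , v)) along-G
  ...   | _ , u∼u′ , refl = suc k′ , ℕ.s≤s le , step u∼u′ wG

  walk-proj₂ : ∀ {p q k} → Walk (G □ H) p q k → Σ ℕ (λ k′ → k′ ℕ.≤ k × Walk H (proj₂ p) (proj₂ q) k′)
  walk-proj₂ here = 0 , ℕ.z≤n , here
  walk-proj₂ {p = u , v} {q} (step adj w) with ∈-++⁻ (map (λ v′ → (u , v′)) (H.nbrs v)) adj | walk-proj₂ w
  ... | inj₂ along-G | k′ , le , wH with ∈-map⁻ (λ u′ → (u′ , v)) along-G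
  ...   | _ , _ , refl = k′ , ℕP.m≤n⇒m≤1+n le , wH
  walk-proj₂ {p = u , v} {q} (step adj w) | inj₁ along-H | k′ , le , wH with ∈-map⁻ (λ v′ → (u , v′)) along-H
  ...   | _ , v∼v′ , refl = suc k′ , ℕ.s≤s le , step v∼v′ wH

  adj-inj₁ : ∀ {a b} v → Adj G a b → Adj (G □ H) (a , v) (b , v)
  adj-inj₁ {a} v adj = ∈-++⁺ʳ (map (λ v′ → (a , v′)) (H.nbrs v)) (∈-map⁺ (λ u′ → (u′ , v)) adj)

  adj-inj₂ : ∀ {b c} a → Adj H b c → Adj (G □ H) (a , b) (a , c)
  adj-inj₂ a adj = ∈-++⁺ˡ (∈-map⁺ (λ v′ → (a , v′)) adj)

  walk-inj₁ : ∀ {a b k} v → Walk G a b k → Walk (G □ H) (a , v) (b , v) k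
  walk-inj₁ v here         = here
  walk-inj₁ v (step adj w) = step (adj-inj₁ v adj) (walk-inj₁ v w)

  walk-inj₂ : ∀ {b c k} a → Walk H b c k → Walk (G □ H) (a , b) (a , c) k
  walk-inj₂ a here         = here
  walk-inj₂ a (step adj w) = step (adj-inj₂ a adj) (walk-inj₂ a w)

-- Distances along an edge of P lying in a fibre ι(F) of a 1-Lipschitz retraction π : P → F.
module FactorEdge (P F : PreGraph) (π : PreGraph.V P → PreGraph.V F) (ι : PreGraph.V F → PreGraph.V P)
  (π∘ι : ∀ a → π (ι a) ≡ a)
  (walk-π : ∀ {p q k} → Walk P p q k → Σ ℕ (λ k′ → k′ ℕ.≤ k × Walk F (π p) (π q) k′))
  (walk-ι : ∀ {a b k} → Walk F a b k → Walk P (ι a) (ι b) k) where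

  Dist-ι : ∀ {a b k} → Dist P (ι a) (ι b) k → Dist F a b k
  Dist-ι {a} {b} {k} (w , shortest) with walk-π w
  ... | k′ , k′≤k , w′ = subst (Walk F a b) (ℕP.≤-antisym k′≤k (shortest k′ (walk-ι w″))) w″ ,
                          λ l wl → shortest l (walk-ι wl)
    where
    w″ : Walk F a b k′
    w″ = subst₂ (λ a′ b′ → Walk F a′ b′ k′) (π∘ι a) (π∘ι b) w′

  Dist-π≤ : ∀ {p q k l} → Dist F (π p) (π q) k → Walk P p q l → k ℕ.≤ l
  Dist-π≤ (_ , shortest) w with walk-π w
  ... | k′ , k′≤l , w′ = ℕP.≤-trans (shortest k′ w′) k′≤l

  π-lookup : ∀ {z m} (S : SupportSplit (deg P (ι z)) (deg F z) m) →
    (∀ i → lookup (supp P (ι z)) (SupportSplit.unsplit S (inj₁ i)) ≡ ι (lookup (supp F z) i)) →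
    (∀ k → π (lookup (supp P (ι z)) (SupportSplit.unsplit S (inj₂ k))) ≡ z) →
    ∀ s → π (lookup (supp P (ι z)) s) ≡ lookup (supp F z) (toFactor (SupportSplit.split S s))
  π-lookup {z} S factor other s =
    trans (cong (λ r → π (lookup (supp P (ι z)) r)) (sym (unsplit-split s))) (by-cases (split s))
    where
    open SupportSplit S
    by-cases : ∀ x → π (lookup (supp P (ι z)) (unsplit x)) ≡ lookup (supp F z) (toFactor x)
    by-cases (inj₁ i) = trans (cong π (factor i)) (π∘ι _)
    by-cases (inj₂ k) = other k

  module Edge (x y : PreGraph.V F) {m : ℕ}
    (X : SupportSplit (deg P (ι x)) (deg F x) m) (Y : SupportSplit (deg P (ι y)) (deg F y) m)
    (X-factor : ∀ i → lookup (supp P (ι x)) (SupportSplit.unsplit X (inj₁ i)) ≡ ι (lookup (supp F x) i))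
    (Y-factor : ∀ i → lookup (supp P (ι y)) (SupportSplit.unsplit Y (inj₁ i)) ≡ ι (lookup (supp F y) i))
    (X-other : ∀ k → π (lookup (supp P (ι x)) (SupportSplit.unsplit X (inj₂ k))) ≡ x)
    (Y-other : ∀ k → π (lookup (supp P (ι y)) (SupportSplit.unsplit Y (inj₂ k))) ≡ y)
    (parallel : ∀ k → Adj P (lookup (supp P (ι x)) (SupportSplit.unsplit X (inj₂ k)))
                             (lookup (supp P (ι y)) (SupportSplit.unsplit Y (inj₂ k))))
    (x∼y : Adj P (ι x) (ι y)) (ιx≢ιy : ¬ ι x ≡ ι y) where

    private
      module X = SupportSplit X
      module Y = SupportSplit Y

    restrict : ∀ D → IsDistFn P (ι x) (ι y) D → IsDistFn F x y (λ i j → D (X.unsplit (inj₁ i)) (Y.unsplit (inj₁ j)))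
    restrict D D-dist i j = Dist-ι (subst₂ (λ p q → Dist P p q (D (X.unsplit (inj₁ i)) (Y.unsplit (inj₁ j)))) (X-factor i) (Y-factor j)
      (D-dist (X.unsplit (inj₁ i)) (Y.unsplit (inj₁ j))))

    edgeDistances : ∀ D → IsDistFn P (ι x) (ι y) D → EdgeDistances X Y D
    edgeDistances D D-dist = record
      { projection≤ = λ s t → Dist-π≤
          (subst₂ (λ a b → Dist F a b _) (sym (π-lookup X X-factor X-other s)) (sym (π-lookup Y Y-factor Y-other t))
            (restrict D D-dist _ _))
          (proj₁ (D-dist s t))
      ; parallel≤1 = λ k → Dist-adj≤1 (D-dist _ _) (parallel k)
      ; edge≡1 = Dist-adj≡1 (D-dist zero zero) x∼y ιx≢ιy }

    curvatureZero : ∀ n₀ → deg F x ≡ suc n₀ → deg F y ≡ suc n₀ →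
      deg P (ι x) ≡ deg F x ℕ.+ m → deg P (ι y) ≡ deg F y ℕ.+ m →
      CurvatureZero F x y → CurvatureZero P (ι x) (ι y)
    curvatureZero n₀ dx dy dPx dPy flat = curvatureZero-product n₀ m
      (trans dPx (cong (ℕ._+ m) dx)) (trans dPy (cong (ℕ._+ m) dy)) dx dy
      X Y (IsDistFn F x y) flat (IsDistFn P (ι x) (ι y)) restrict edgeDistances

module ProductEdges (G H : PreGraph) (G-graph : IsGraph G) (H-graph : IsGraph H) where
  private
    module G = PreGraph G
    module H = PreGraph H
  open ProductWalks G H
  open ListP using (length-++; length-map)

  curvatureZero-along-G : ∀ x y v → Adj G x y → deg G y ≡ deg G x →
    CurvatureZero G x y → CurvatureZero (G □ H) (x , v) (y , v)
  curvatureZero-along-G x y v x∼y dy≡dx =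
    Edge.curvatureZero (ℕ.pred (deg G x)) (length≡suc-pred x∼y) (trans dy≡dx (length≡suc-pred x∼y)) (deg-□ x) (deg-□ y)
    where
    module Index a = ConcatMaps (λ v′ → (a , v′)) (λ u′ → (u′ , v)) (H.nbrs v) (G.nbrs a)
    split : ∀ a → SupportSplit (deg (G □ H) (a , v)) (deg G a) (length (H.nbrs v))
    split a = Indexing.withCentre (Indexing.swapped (Index.indexing a))
    factor-lookup : ∀ a i → lookup (supp (G □ H) (a , v)) (SupportSplit.unsplit (split a) (inj₁ i)) ≡ (lookup (supp G a) i , v)
    factor-lookup a zero    = refl
    factor-lookup a (suc i) = Index.lookup-from₂ a i
    parallel : ∀ k → Adj (G □ H) (lookup (supp (G □ H) (x , v)) (SupportSplit.unsplit (split x) (inj₂ k)))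
                                  (lookup (supp (G □ H) (y , v)) (SupportSplit.unsplit (split y) (inj₂ k)))
    parallel k = subst₂ (Adj (G □ H)) (sym (Index.lookup-from₁ x k)) (sym (Index.lookup-from₁ y k))
                   (adj-inj₁ (lookup (H.nbrs v) k) x∼y)
    deg-□ : ∀ a → deg (G □ H) (a , v) ≡ deg G a ℕ.+ length (H.nbrs v)
    deg-□ a = trans (length-++ (map (λ v′ → (a , v′)) (H.nbrs v)))
      (trans (cong₂ ℕ._+_ (length-map _ (H.nbrs v)) (length-map _ (G.nbrs a))) (ℕP.+-comm (length (H.nbrs v)) (deg G a)))
    module Edge = FactorEdge.Edge (G □ H) G proj₁ (_, v) (λ _ → refl) walk-proj₁ (walk-inj₁ v) x y (split x) (split y)
      (factor-lookup x) (factor-lookup y) (λ k → cong proj₁ (Index.lookup-from₁ x k)) (λ k → cong proj₁ (Index.lookup-from₁ y k))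
      parallel (adj-inj₁ v x∼y) (λ e → IsGraph.irrefl G-graph x (subst (_∈ G.nbrs x) (sym (cong proj₁ e)) x∼y))

  curvatureZero-along-H : ∀ x v w → Adj H v w → deg H w ≡ deg H v →
    CurvatureZero H v w → CurvatureZero (G □ H) (x , v) (x , w)
  curvatureZero-along-H x v w v∼w dw≡dv =
    Edge.curvatureZero (ℕ.pred (deg H v)) (length≡suc-pred v∼w) (trans dw≡dv (length≡suc-pred v∼w)) (deg-□ v) (deg-□ w)
    where
    module Index b = ConcatMaps (λ v′ → (x , v′)) (λ u′ → (u′ , b)) (H.nbrs b) (G.nbrs x)
    split : ∀ b → SupportSplit (deg (G □ H) (x , b)) (deg H b) (length (G.nbrs x))
    split b = Indexing.withCentre (Index.indexing b)
    factor-lookup : ∀ b i → lookup (supp (G □ H) (x , b)) (SupportSplit.unsplit (split b) (inj₁ i)) ≡ (x , lookup (supp H b) i)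
    factor-lookup b zero    = refl
    factor-lookup b (suc i) = Index.lookup-from₁ b i
    parallel : ∀ k → Adj (G □ H) (lookup (supp (G □ H) (x , v)) (SupportSplit.unsplit (split v) (inj₂ k)))
                                  (lookup (supp (G □ H) (x , w)) (SupportSplit.unsplit (split w) (inj₂ k)))
    parallel k = subst₂ (Adj (G □ H)) (sym (Index.lookup-from₂ v k)) (sym (Index.lookup-from₂ w k))
                   (adj-inj₂ (lookup (G.nbrs x) k) v∼w)
    deg-□ : ∀ b → deg (G □ H) (x , b) ≡ deg H b ℕ.+ length (G.nbrs x)
    deg-□ b = trans (length-++ (map (λ v′ → (x , v′)) (H.nbrs b)))
      (cong₂ ℕ._+_ (length-map _ (H.nbrs b)) (length-map _ (G.nbrs x)))
    module Edge = FactorEdge.Edge (G □ H) H proj₂ (x ,_) (λ _ → refl) walk-proj₂ (walk-inj₂ x) v w (split v) (split w)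
      (factor-lookup v) (factor-lookup w) (λ k → cong proj₂ (Index.lookup-from₂ v k)) (λ k → cong proj₂ (Index.lookup-from₂ w k))
      parallel (adj-inj₂ x v∼w) (λ e → IsGraph.irrefl H-graph v (subst (_∈ H.nbrs v) (sym (cong proj₂ e)) v∼w))

corollary2 : (G H : PreGraph) → IsGraph G → IsGraph H → Regular G → Regular H → RicciFlat G → RicciFlat H → RicciFlat (G □ H)
corollary2 G H G-graph H-graph (_ , G-regular) (_ , H-regular) G-flat H-flat (x , v) z edge =
  along (∈-++⁻ (map (λ v′ → (x , v′)) (PreGraph.nbrs H v)) edge)
  where
  open ProductEdges G H G-graph H-graph
  Goal : PreGraph.V (G □ H) → Set
  Goal = CurvatureZero (G □ H) (x , v)
  along-H : Σ _ (λ w → Adj H v w × z ≡ (x , w)) → Goal z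
  along-H (w , v∼w , refl) = curvatureZero-along-H x v w v∼w (trans (H-regular w) (sym (H-regular v))) (H-flat v w v∼w)
  along-G : Σ _ (λ y → Adj G x y × z ≡ (y , v)) → Goal z
  along-G (y , x∼y , refl) = curvatureZero-along-G x y v x∼y (trans (G-regular y) (sym (G-regular x))) (G-flat x y x∼y)
  along : z ∈ map (λ v′ → (x , v′)) (PreGraph.nbrs H v) ⊎ z ∈ map (λ u′ → (u′ , v)) (PreGraph.nbrs G x) → Goal z
  along (inj₁ along-H-list) = along-H (∈-map⁻ (λ v′ → (x , v′)) along-H-list)
  along (inj₂ along-G-list) = along-G (∈-map⁻ (λ u′ → (u′ , v)) along-G-list)
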